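{- For every integer $n\geq0$, \[ (q;q)_{2n}\,CP_{(4,0)}(n) = \sum_{r= -\infty}^\infty (-1)^r q^{r(3r+2)} {2 n\brack n-3r+(-1)^r-1}_q. \]
   Context: $(a;q)_m=\prod_{j=0}^{m-1}(1-aq^j)$; for integers $a,b$, ${a\brack b}_q=\frac{(q;q)_a}{(q;q)_b(q;q)_{a-b}}$ if $0\le b\le a$ and $0$ otherwise. A cylindric partition with profile $(c_1,c_2)$ is a pair of partitions $(\lambda^{(1)},\lambda^{(2)})$ (parts weakly decreasing, $\lambda^{(i)}_j=0$ beyond the number of parts) with $\lambda^{(1)}_j\ge\lambda^{(2)}_{j+c_2}$ and $\lambda^{(2)}_j\ge\lambda^{(1)}_{j+c_1}$ for all $j\ge1$; its size is $|\lambda^{(1)}|+|\lambda^{(2)}|$. $CP_{(4,0)}(n)$ is the generating function $\sum q^{\text{size}}$ over cylindric partitions of profile $(4,0)$ in which each partition has at most $n$ parts, with $CP_{(4,0)}(0)=1$. -}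

module Defs where

open import Data.Nat as ℕ using (ℕ; zero; suc; _≤_; _∸_; _%_; _≤ᵇ_)
open import Data.Integer as ℤ using (ℤ; +_; -[1+_]; ∣_∣)
open import Data.Bool using (Bool; true; false; if_then_else_)
open import Data.Vec using (Vec; []; _∷_)
open import Data.Product using (_×_; _,_)
open import Relation.Binary.PropositionalEquality using (_≡_)

-- Formal power series in q with integer coefficients: coefficient functions.
Series : Set
Series = ℕ → ℤ

sumTo : ℕ → (ℕ → ℤ) → ℤ
sumTo zero    f = f 0
sumTo (suc N) f = sumTo N f ℤ.+ f (suc N)

_⊛_ : Series → Series → Series
(f ⊛ g) N = sumTo N (λ k → f k ℤ.* g (N ∸ k))

oneS : Series
oneS zero    = + 1
oneS (suc _) = + 0

zeroS : Series
zeroS _ = + 0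

δ : ℕ → ℕ → ℤ
δ j N = if (j ℕ.≡ᵇ N) then + 1 else + 0

oneMinusQ^ : ℕ → Series
oneMinusQ^ j N = oneS N ℤ.- δ j N

qPoch : ℕ → Series
qPoch zero    = oneS
qPoch (suc m) = qPoch m ⊛ oneMinusQ^ (suc m)

-- 1/(1 - q^{j+1}) = Σ_k q^{(j+1)k}
geomInv : ℕ → Series
geomInv j N with N % suc j
... | zero  = + 1
... | suc _ = + 0

invQPoch : ℕ → Series
invQPoch zero    = oneS
invQPoch (suc m) = invQPoch m ⊛ geomInv m

qBinom : ℕ → ℕ → Series
qBinom a b = if b ≤ᵇ a then qPoch a ⊛ (invQPoch b ⊛ invQPoch (a ∸ b)) else zeroS

qBinomℤ : ℕ → ℤ → Series
qBinomℤ a (+ b)     = qBinom a b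
qBinomℤ a -[1+ _ ]  = zeroS

-- coefficient of q^N in q^e · f, for integers N - e given as d
coeffShift : Series → ℤ → ℤ
coeffShift f (+ m)     = f m
coeffShift f -[1+ _ ]  = + 0

sumSym : ℕ → (ℤ → ℤ) → ℤ
sumSym zero    g = g (+ 0)
sumSym (suc R) g = sumSym R g ℤ.+ g (+ suc R) ℤ.+ g -[1+ R ]

signℤ : ℤ → ℤ
signℤ r = (ℤ.- (+ 1)) ℤ.^ ∣ r ∣

-- coefficient of q^N in  Σ_{r∈ℤ} (-1)^r q^{r(3r+2)} [2n, n-3r+(-1)^r-1]_q .
-- Since r(3r+2) ≥ |r| for every integer r, only |r| ≤ N contribute to q^N.
rhsCoeff : ℕ → ℕ → ℤ
rhsCoeff n N = sumSym N (λ r →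
  signℤ r ℤ.* coeffShift
    (qBinomℤ (2 ℕ.* n) (+ n ℤ.- (+ 3) ℤ.* r ℤ.+ signℤ r ℤ.- + 1))
    (+ N ℤ.- r ℤ.* ((+ 3) ℤ.* r ℤ.+ + 2)))

-- Cylindric partitions of profile (4,0) with at most n parts each.
-- A partition with at most n parts is a vector (λ_1,…,λ_n), λ_j = 0 beyond n.

-- 0-indexed part lookup, 0 beyond the length
part : {n : ℕ} → Vec ℕ n → ℕ → ℕ
part []       _       = 0
part (x ∷ _)  zero    = x
part (_ ∷ xs) (suc j) = part xs j

vsum : {n : ℕ} → Vec ℕ n → ℕ
vsum []       = 0
vsum (x ∷ xs) = x ℕ.+ vsum xs

IsPartition : {n : ℕ} → Vec ℕ n → Set
IsPartition v = ∀ j → part v (suc j) ≤ part v j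

-- profile (c₁,c₂) = (4,0):  λ¹_j ≥ λ²_{j+0},  λ²_j ≥ λ¹_{j+4}; size N
IsCP40 : (n N : ℕ) → Vec ℕ n × Vec ℕ n → Set
IsCP40 n N (l1 , l2) =
  IsPartition l1 × IsPartition l2 ×
  (∀ j → part l2 (j ℕ.+ 0) ≤ part l1 j) ×
  (∀ j → part l1 (j ℕ.+ 4) ≤ part l2 j) ×
  (vsum l1 ℕ.+ vsum l2 ≡ N)

module Submission where

-- The identity is the case a = b = n of (q;q)_{a+b} count a b = rhs a b, where count a b
-- counts the cylindric pairs of profile (4,0) with at most a and at most b parts
-- (b ≤ a ≤ b + 4) and rhs a b = Σ_r (-1)^r q^{r(3r+2)} [a+b, ℓ_r] with ℓ_r = b - 3r for
-- even r and ℓ_r = a - 3r - 2 for odd r.  Call a pair of type 1 if its first partition has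
-- more slots and its last entry is at most the last entry of the second one.  Deleting a
-- trailing zero, or the first column of both diagrams (which lowers the size by a + b),
-- gives linear recurrences for the numbers of pairs of each type.  The q-Pascal rules give
-- the same recurrences for rhs, and the boundary cases rhs (c+1) (c+1) = rhs (c+1) c and
-- rhs (c+4) c = rhs (c+3) c are telescoping sums, so induction on (a , b) concludes.

module PowerSeries where

  open import Defs
  open import Data.Nat as ℕ using (ℕ; zero; suc; z≤n; s≤s; _∸_)
  import Data.Nat.Properties as ℕ
  open import Data.Integer as ℤ using (ℤ; +_; _+_; _*_; -_; _-_)
  import Data.Integer.Properties as ℤ
  open import Data.Integer.Solver using (module +-*-Solver)
  open import Data.Product using (_,_)
  open import Algebra.Bundles using (CommutativeMonoid)
  open import Relation.Binary.Bundles using (Setoid)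
  open import Relation.Binary.PropositionalEquality
  open +-*-Solver using (solve; _:+_; _:-_; :-_; _:*_; _:=_)

  sumTo-cong : ∀ N {f g : ℕ → ℤ} → (∀ i → i ℕ.≤ N → f i ≡ g i) → sumTo N f ≡ sumTo N g
  sumTo-cong zero    f≡g = f≡g 0 z≤n
  sumTo-cong (suc N) f≡g =
    cong₂ _+_ (sumTo-cong N (λ i i≤N → f≡g i (ℕ.m≤n⇒m≤1+n i≤N))) (f≡g (suc N) ℕ.≤-refl)

  sumTo-cong-≗ : ∀ N {f g : ℕ → ℤ} → f ≗ g → sumTo N f ≡ sumTo N g
  sumTo-cong-≗ N f≗g = sumTo-cong N (λ i _ → f≗g i)

  sumTo-zero : ∀ N (f : ℕ → ℤ) → (∀ i → i ℕ.≤ N → f i ≡ + 0) → sumTo N f ≡ + 0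
  sumTo-zero zero    f f≡0 = f≡0 0 z≤n
  sumTo-zero (suc N) f f≡0 =
    cong₂ _+_ (sumTo-zero N f (λ i i≤N → f≡0 i (ℕ.m≤n⇒m≤1+n i≤N))) (f≡0 (suc N) ℕ.≤-refl)

  sumTo-distrib-+ : ∀ N f g → sumTo N (λ i → f i + g i) ≡ sumTo N f + sumTo N g
  sumTo-distrib-+ zero    f g = refl
  sumTo-distrib-+ (suc N) f g rewrite sumTo-distrib-+ N f g =
    solve 4 (λ a b c d → (a :+ b) :+ (c :+ d) := (a :+ c) :+ (b :+ d)) refl
      (sumTo N f) (sumTo N g) (f (suc N)) (g (suc N))

  sumTo-neg : ∀ N f → sumTo N (λ i → - f i) ≡ - sumTo N f
  sumTo-neg zero    f = refl
  sumTo-neg (suc N) f rewrite sumTo-neg N f = sym (ℤ.neg-distrib-+ (sumTo N f) (f (suc N)))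

  *-distribˡ-sumTo : ∀ N c f → c * sumTo N f ≡ sumTo N (λ i → c * f i)
  *-distribˡ-sumTo zero    c f = refl
  *-distribˡ-sumTo (suc N) c f rewrite sym (*-distribˡ-sumTo N c f) = ℤ.*-distribˡ-+ c (sumTo N f) (f (suc N))

  sumTo-unfoldˡ : ∀ N f → sumTo (suc N) f ≡ f 0 + sumTo N (λ i → f (suc i))
  sumTo-unfoldˡ zero    f = refl
  sumTo-unfoldˡ (suc N) f rewrite sumTo-unfoldˡ N f =
    ℤ.+-assoc (f 0) (sumTo N (λ i → f (suc i))) (f (suc (suc N)))

  sumTo-reverse : ∀ N f → sumTo N f ≡ sumTo N (λ i → f (N ∸ i))
  sumTo-reverse zero    f = refl
  sumTo-reverse (suc N) f rewrite sumTo-reverse N f =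
    trans (ℤ.+-comm (sumTo N (λ i → f (N ∸ i))) (f (suc N))) (sym (sumTo-unfoldˡ N (λ i → f (suc N ∸ i))))

  sumTo-triangle : ∀ N (A : ℕ → ℕ → ℤ) →
    sumTo N (λ k → sumTo k (λ i → A i (k ∸ i))) ≡ sumTo N (λ i → sumTo (N ∸ i) (A i))
  sumTo-triangle zero    A = refl
  sumTo-triangle (suc N) A = begin
    sumTo N (λ k → sumTo k (λ i → A i (k ∸ i))) + sumTo (suc N) (λ i → A i (suc N ∸ i))
      ≡⟨ cong (_+ sumTo (suc N) (λ i → A i (suc N ∸ i))) (sumTo-triangle N A) ⟩
    sumTo N (λ i → sumTo (N ∸ i) (A i)) + (sumTo N (λ i → A i (suc N ∸ i)) + A (suc N) (N ∸ N))
      ≡⟨ sym (ℤ.+-assoc (sumTo N (λ i → sumTo (N ∸ i) (A i))) (sumTo N (λ i → A i (suc N ∸ i))) (A (suc N) (N ∸ N))) ⟩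
    sumTo N (λ i → sumTo (N ∸ i) (A i)) + sumTo N (λ i → A i (suc N ∸ i)) + A (suc N) (N ∸ N)
      ≡⟨ cong (_+ A (suc N) (N ∸ N)) (sym (sumTo-distrib-+ N _ _)) ⟩
    sumTo N (λ i → sumTo (N ∸ i) (A i) + A i (suc N ∸ i)) + A (suc N) (N ∸ N)
      ≡⟨ cong₂ _+_ (sumTo-cong N row) corner ⟩
    sumTo N (λ i → sumTo (suc N ∸ i) (A i)) + sumTo (suc N ∸ suc N) (A (suc N)) ∎
    where
    open ≡-Reasoning
    row : ∀ i → i ℕ.≤ N → sumTo (N ∸ i) (A i) + A i (suc N ∸ i) ≡ sumTo (suc N ∸ i) (A i)
    row i i≤N rewrite ℕ.+-∸-assoc 1 i≤N = refl
    corner : A (suc N) (N ∸ N) ≡ sumTo (N ∸ N) (A (suc N))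
    corner rewrite ℕ.n∸n≡0 N = refl

  infixl 6 _⊕_ _⊖_

  _⊕_ : Series → Series → Series
  (f ⊕ g) N = f N + g N

  _⊖_ : Series → Series → Series
  (f ⊖ g) N = f N - g N

  ⊕-cong : ∀ {f f′ g g′} → f ≗ f′ → g ≗ g′ → f ⊕ g ≗ f′ ⊕ g′
  ⊕-cong f≗f′ g≗g′ N = cong₂ _+_ (f≗f′ N) (g≗g′ N)

  ⊕-congʳ : ∀ f {g g′} → g ≗ g′ → f ⊕ g ≗ f ⊕ g′
  ⊕-congʳ f g≗g′ N = cong (_+_ (f N)) (g≗g′ N)

  shift : ℕ → Series → Series
  shift zero    f N       = f N
  shift (suc j) f zero    = + 0
  shift (suc j) f (suc N) = shift j f N

  shift-≥ : ∀ j f {N} → j ℕ.≤ N → shift j f N ≡ f (N ∸ j)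
  shift-≥ zero    f         _         = refl
  shift-≥ (suc j) f {suc N} (s≤s j≤N) = shift-≥ j f j≤N

  shift-< : ∀ j f {N} → N ℕ.< j → shift j f N ≡ + 0
  shift-< (suc j) f {zero}  _         = refl
  shift-< (suc j) f {suc N} (s≤s N<j) = shift-< j f N<j

  shift-cong : ∀ j {f g} → f ≗ g → shift j f ≗ shift j g
  shift-cong zero    f≗g N       = f≗g N
  shift-cong (suc j) f≗g zero    = refl
  shift-cong (suc j) f≗g (suc N) = shift-cong j f≗g N

  ⊛-cong : ∀ {f f′ g g′} → f ≗ f′ → g ≗ g′ → f ⊛ g ≗ f′ ⊛ g′
  ⊛-cong f≗f′ g≗g′ N = sumTo-cong-≗ N (λ i → cong₂ _*_ (f≗f′ i) (g≗g′ (N ∸ i)))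

  ⊛-congˡ : ∀ {f f′} g → f ≗ f′ → f ⊛ g ≗ f′ ⊛ g
  ⊛-congˡ g f≗f′ = ⊛-cong {g = g} f≗f′ (λ _ → refl)

  ⊛-congʳ : ∀ f {g g′} → g ≗ g′ → f ⊛ g ≗ f ⊛ g′
  ⊛-congʳ f g≗g′ = ⊛-cong {f} (λ _ → refl) g≗g′

  ⊛-comm : ∀ f g → f ⊛ g ≗ g ⊛ f
  ⊛-comm f g N = trans (sumTo-reverse N (λ i → f i * g (N ∸ i))) (sumTo-cong N swap)
    where
    swap : ∀ i → i ℕ.≤ N → f (N ∸ i) * g (N ∸ (N ∸ i)) ≡ g i * f (N ∸ i)
    swap i i≤N rewrite ℕ.m∸[m∸n]≡n i≤N = ℤ.*-comm (f (N ∸ i)) (g i)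

  ⊛-assoc : ∀ f g h → (f ⊛ g) ⊛ h ≗ f ⊛ (g ⊛ h)
  ⊛-assoc f g h N = begin
    sumTo N (λ k → sumTo k (λ i → f i * g (k ∸ i)) * h (N ∸ k))
      ≡⟨ sumTo-cong-≗ N (λ k → trans (ℤ.*-comm _ (h (N ∸ k))) (*-distribˡ-sumTo k (h (N ∸ k)) _)) ⟩
    sumTo N (λ k → sumTo k (λ i → h (N ∸ k) * (f i * g (k ∸ i))))
      ≡⟨ sumTo-cong N (λ k k≤N → sumTo-cong k (λ i i≤k → antidiagonal k i i≤k)) ⟩
    sumTo N (λ k → sumTo k (λ i → A i (k ∸ i)))
      ≡⟨ sumTo-triangle N A ⟩
    sumTo N (λ i → sumTo (N ∸ i) (A i))
      ≡⟨ sumTo-cong-≗ N (λ i → trans (sumTo-cong-≗ (N ∸ i) (row i)) (sym (*-distribˡ-sumTo (N ∸ i) (f i) _))) ⟩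
    sumTo N (λ i → f i * sumTo (N ∸ i) (λ j → g j * h (N ∸ i ∸ j))) ∎
    where
    open ≡-Reasoning
    A : ℕ → ℕ → ℤ
    A i j = f i * (g j * h (N ∸ (i ℕ.+ j)))
    antidiagonal : ∀ k i → i ℕ.≤ k → h (N ∸ k) * (f i * g (k ∸ i)) ≡ A i (k ∸ i)
    antidiagonal k i i≤k rewrite ℕ.m+[n∸m]≡n i≤k =
      solve 3 (λ x y z → x :* (y :* z) := y :* (z :* x)) refl (h (N ∸ k)) (f i) (g (k ∸ i))
    row : ∀ i j → A i j ≡ f i * (g j * h (N ∸ i ∸ j))
    row i j rewrite ℕ.∸-+-assoc N i j = refl

  ⊛-distribˡ-⊕ : ∀ f g h → f ⊛ (g ⊕ h) ≗ (f ⊛ g) ⊕ (f ⊛ h)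
  ⊛-distribˡ-⊕ f g h N =
    trans (sumTo-cong-≗ N (λ i → ℤ.*-distribˡ-+ (f i) (g (N ∸ i)) (h (N ∸ i)))) (sumTo-distrib-+ N _ _)

  ⊛-distribˡ-⊖ : ∀ f g h → f ⊛ (g ⊖ h) ≗ (f ⊛ g) ⊖ (f ⊛ h)
  ⊛-distribˡ-⊖ f g h N = begin
    sumTo N (λ i → f i * (g (N ∸ i) - h (N ∸ i)))
      ≡⟨ sumTo-cong-≗ N (λ i → distrib (f i) (g (N ∸ i)) (h (N ∸ i))) ⟩
    sumTo N (λ i → f i * g (N ∸ i) + - (f i * h (N ∸ i)))
      ≡⟨ sumTo-distrib-+ N _ _ ⟩
    sumTo N (λ i → f i * g (N ∸ i)) + sumTo N (λ i → - (f i * h (N ∸ i)))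
      ≡⟨ cong (_+_ (sumTo N (λ i → f i * g (N ∸ i)))) (sumTo-neg N _) ⟩
    sumTo N (λ i → f i * g (N ∸ i)) - sumTo N (λ i → f i * h (N ∸ i)) ∎
    where
    open ≡-Reasoning
    distrib : ∀ a b c → a * (b - c) ≡ a * b + - (a * c)
    distrib = solve 3 (λ a b c → a :* (b :- c) := a :* b :+ :- (a :* c)) refl

  ⊛-distribʳ-⊕ : ∀ f g h → (g ⊕ h) ⊛ f ≗ (g ⊛ f) ⊕ (h ⊛ f)
  ⊛-distribʳ-⊕ f g h N =
    trans (⊛-comm (g ⊕ h) f N) (trans (⊛-distribˡ-⊕ f g h N) (cong₂ _+_ (⊛-comm f g N) (⊛-comm f h N)))

  ⊛-identityˡ : ∀ f → oneS ⊛ f ≗ f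
  ⊛-identityˡ f zero    = ℤ.*-identityˡ (f 0)
  ⊛-identityˡ f (suc N) = begin
    sumTo (suc N) (λ i → oneS i * f (suc N ∸ i))
      ≡⟨ sumTo-unfoldˡ N _ ⟩
    + 1 * f (suc N) + sumTo N (λ i → + 0 * f (N ∸ i))
      ≡⟨ cong₂ _+_ (ℤ.*-identityˡ (f (suc N))) (sumTo-zero N _ (λ i _ → ℤ.*-zeroˡ (f (N ∸ i)))) ⟩
    f (suc N) + + 0
      ≡⟨ ℤ.+-identityʳ (f (suc N)) ⟩
    f (suc N) ∎
    where open ≡-Reasoning

  ⊛-identityʳ : ∀ f → f ⊛ oneS ≗ f
  ⊛-identityʳ f N = trans (⊛-comm f oneS N) (⊛-identityˡ f N)

  δ-⊛ : ∀ j f → δ j ⊛ f ≗ shift j f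
  δ-⊛ zero    f N       = trans (⊛-congˡ f δ₀≗oneS N) (⊛-identityˡ f N)
    where
    δ₀≗oneS : δ 0 ≗ oneS
    δ₀≗oneS zero    = refl
    δ₀≗oneS (suc _) = refl
  δ-⊛ (suc j) f zero    = ℤ.*-zeroˡ (f 0)
  δ-⊛ (suc j) f (suc N) =
    trans (sumTo-unfoldˡ N _) (trans (cong₂ _+_ (ℤ.*-zeroˡ (f (suc N))) (δ-⊛ j f N)) (ℤ.+-identityˡ _))

  oneMinusQ^-⊛ : ∀ j f → oneMinusQ^ j ⊛ f ≗ f ⊖ shift j f
  oneMinusQ^-⊛ j f N = begin
    sumTo N (λ i → (oneS i - δ j i) * f (N ∸ i))
      ≡⟨ sumTo-cong-≗ N (λ i → distrib (oneS i) (δ j i) (f (N ∸ i))) ⟩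
    sumTo N (λ i → oneS i * f (N ∸ i) + - (δ j i * f (N ∸ i)))
      ≡⟨ sumTo-distrib-+ N _ _ ⟩
    (oneS ⊛ f) N + sumTo N (λ i → - (δ j i * f (N ∸ i)))
      ≡⟨ cong₂ _+_ (⊛-identityˡ f N) (trans (sumTo-neg N _) (cong -_ (δ-⊛ j f N))) ⟩
    f N - shift j f N ∎
    where
    open ≡-Reasoning
    distrib : ∀ a b c → (a - b) * c ≡ a * c + - (b * c)
    distrib = solve 3 (λ a b c → (a :- b) :* c := a :* c :+ :- (b :* c)) refl

  ⊛-commutativeMonoid : CommutativeMonoid _ _
  ⊛-commutativeMonoid = record
    { Carrier = Series ; _≈_ = _≗_ ; _∙_ = _⊛_ ; ε = oneS
    ; isCommutativeMonoid = record
      { isMonoid = record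
        { isSemigroup = record
          { isMagma = record { isEquivalence = Setoid.isEquivalence (ℕ →-setoid ℤ) ; ∙-cong = ⊛-cong }
          ; assoc = ⊛-assoc }
        ; identity = ⊛-identityˡ , ⊛-identityʳ }
      ; comm = ⊛-comm } }

  open import Algebra.Properties.CommutativeSemigroup
    (CommutativeMonoid.commutativeSemigroup ⊛-commutativeMonoid) public
    using (interchange; x∙yz≈y∙xz; x∙yz≈z∙xy; xy∙z≈y∙xz)

  ⊛-shift : ∀ f j g → f ⊛ shift j g ≗ shift j (f ⊛ g)
  ⊛-shift f j g N = begin
    (f ⊛ shift j g) N      ≡⟨ ⊛-congʳ f (λ M → sym (δ-⊛ j g M)) N ⟩
    (f ⊛ (δ j ⊛ g)) N      ≡⟨ x∙yz≈y∙xz f (δ j) g N ⟩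
    (δ j ⊛ (f ⊛ g)) N      ≡⟨ δ-⊛ j (f ⊛ g) N ⟩
    shift j (f ⊛ g) N      ∎
    where open ≡-Reasoning

  ⊛-shift-⊕ : ∀ f i g h → f ⊛ h ⊕ shift i (g ⊛ h) ≗ (f ⊕ shift i g) ⊛ h
  ⊛-shift-⊕ f i g h N = begin
    (f ⊛ h) N + shift i (g ⊛ h) N  ≡⟨ cong (_+_ ((f ⊛ h) N)) (shift-cong i (⊛-comm g h) N) ⟩
    (f ⊛ h) N + shift i (h ⊛ g) N  ≡⟨ cong (_+_ ((f ⊛ h) N)) (⊛-shift h i g N) ⟨
    (f ⊛ h) N + (h ⊛ shift i g) N  ≡⟨ cong (_+_ ((f ⊛ h) N)) (⊛-comm h (shift i g) N) ⟩
    (f ⊛ h) N + (shift i g ⊛ h) N  ≡⟨ ⊛-distribʳ-⊕ h f (shift i g) N ⟨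
    ((f ⊕ shift i g) ⊛ h) N        ∎
    where open ≡-Reasoning

  oneMinusQ^-⊛-fixpoint : ∀ j f g → f ≗ g ⊕ shift j f → oneMinusQ^ j ⊛ f ≗ g
  oneMinusQ^-⊛-fixpoint j f g f≗g+shift N rewrite oneMinusQ^-⊛ j f N | f≗g+shift N =
    solve 2 (λ x y → x :+ y :- y := x) refl (g N) (shift j f N)

module GaussianBinomial where

  open import Defs
  open PowerSeries
  open import Data.Nat as ℕ using (ℕ; zero; suc; s≤s; _∸_)
  import Data.Nat.Properties as ℕ
  open import Data.Nat.DivMod using (_%_; m≤n⇒m%n≡m; m≤n⇒[n∸m]%m≡n%m)
  open import Data.Integer as ℤ using (ℤ; +_; -[1+_]; _+_; _-_)
  import Data.Integer.Properties as ℤ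
  open import Data.Integer.Solver using (module +-*-Solver)
  open import Data.Bool using (true; false)
  open import Data.Sum using (_⊎_; inj₁; inj₂)
  open import Relation.Nullary using (contradiction)
  open import Relation.Binary.PropositionalEquality hiding (setoid)
  open import Relation.Binary.Definitions using (tri<; tri≈; tri>)
  open import Relation.Binary.Reasoning.Setoid (ℕ →-setoid ℤ)
  open +-*-Solver using (solve; _:+_; _:-_; _:=_)

  oneMinusQ^-geomInv : ∀ j → oneMinusQ^ (suc j) ⊛ geomInv j ≗ oneS
  oneMinusQ^-geomInv j N = trans (oneMinusQ^-⊛ (suc j) (geomInv j) N) (difference N (ℕ.<-≤-connex N (suc j)))
    where
    below : ∀ M → M % suc j ≡ M → geomInv j M - + 0 ≡ oneS M
    below M M%j≡M with M % suc j
    below zero    refl | .zero    = refl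
    below (suc M) refl | .(suc M) = refl
    periodic : ∀ M M′ → M % suc j ≡ M′ % suc j → geomInv j M ≡ geomInv j M′
    periodic M M′ eq with M % suc j | M′ % suc j
    periodic M M′ refl | zero  | .zero    = refl
    periodic M M′ refl | suc _ | .(suc _) = refl
    difference : ∀ M → M ℕ.< suc j ⊎ suc j ℕ.≤ M → geomInv j M - shift (suc j) (geomInv j) M ≡ oneS M
    difference M (inj₁ M<j) rewrite shift-< (suc j) (geomInv j) M<j = below M (m≤n⇒m%n≡m (ℕ.≤-pred M<j))
    difference (suc M) (inj₂ j≤M) rewrite shift-≥ (suc j) (geomInv j) j≤M
      | periodic (suc M ∸ suc j) (suc M) (m≤n⇒[n∸m]%m≡n%m j≤M) = ℤ.+-inverseʳ (geomInv j (suc M))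

  qPoch-invQPoch : ∀ m → qPoch m ⊛ invQPoch m ≗ oneS
  qPoch-invQPoch zero    = ⊛-identityˡ oneS
  qPoch-invQPoch (suc m) = begin
    (qPoch m ⊛ oneMinusQ^ (suc m)) ⊛ (invQPoch m ⊛ geomInv m)
      ≈⟨ interchange (qPoch m) (oneMinusQ^ (suc m)) (invQPoch m) (geomInv m) ⟩
    (qPoch m ⊛ invQPoch m) ⊛ (oneMinusQ^ (suc m) ⊛ geomInv m)
      ≈⟨ ⊛-cong (qPoch-invQPoch m) (oneMinusQ^-geomInv m) ⟩
    oneS ⊛ oneS
      ≈⟨ ⊛-identityˡ oneS ⟩
    oneS ∎

  qBinom-≤ : ∀ {a b} → b ℕ.≤ a → qBinom a b ≡ qPoch a ⊛ (invQPoch b ⊛ invQPoch (a ∸ b))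
  qBinom-≤ {a} {b} b≤a with b ℕ.≤ᵇ a | ℕ.≤⇒≤ᵇ b≤a
  ... | true | _ = refl

  qBinom-> : ∀ {a b} → a ℕ.< b → qBinom a b ≡ zeroS
  qBinom-> {a} {b} a<b with b ℕ.≤ᵇ a | ℕ.≤ᵇ⇒≤ b a
  ... | true  | b≤a = contradiction (b≤a _) (ℕ.<⇒≱ a<b)
  ... | false | _   = refl

  qPoch²-invQPoch² : ∀ i k → (qPoch i ⊛ qPoch k) ⊛ (invQPoch i ⊛ invQPoch k) ≗ oneS
  qPoch²-invQPoch² i k = begin
    (qPoch i ⊛ qPoch k) ⊛ (invQPoch i ⊛ invQPoch k)
      ≈⟨ interchange (qPoch i) (qPoch k) (invQPoch i) (invQPoch k) ⟩
    (qPoch i ⊛ invQPoch i) ⊛ (qPoch k ⊛ invQPoch k)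
      ≈⟨ ⊛-cong (qPoch-invQPoch i) (qPoch-invQPoch k) ⟩
    oneS ⊛ oneS
      ≈⟨ ⊛-identityˡ oneS ⟩
    oneS ∎

  qPoch²-qBinom : ∀ i k → (qPoch i ⊛ qPoch k) ⊛ qBinom (i ℕ.+ k) i ≗ qPoch (i ℕ.+ k)
  qPoch²-qBinom i k = begin
    (qPoch i ⊛ qPoch k) ⊛ qBinom (i ℕ.+ k) i
      ≡⟨ cong ((qPoch i ⊛ qPoch k) ⊛_) (qBinom-≤ (ℕ.m≤m+n i k)) ⟩
    (qPoch i ⊛ qPoch k) ⊛ (qPoch (i ℕ.+ k) ⊛ (invQPoch i ⊛ invQPoch (i ℕ.+ k ∸ i)))
      ≡⟨ cong (λ m → (qPoch i ⊛ qPoch k) ⊛ (qPoch (i ℕ.+ k) ⊛ (invQPoch i ⊛ invQPoch m))) (ℕ.m+n∸m≡n i k) ⟩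
    (qPoch i ⊛ qPoch k) ⊛ (qPoch (i ℕ.+ k) ⊛ (invQPoch i ⊛ invQPoch k))
      ≈⟨ x∙yz≈y∙xz (qPoch i ⊛ qPoch k) (qPoch (i ℕ.+ k)) (invQPoch i ⊛ invQPoch k) ⟩
    qPoch (i ℕ.+ k) ⊛ ((qPoch i ⊛ qPoch k) ⊛ (invQPoch i ⊛ invQPoch k))
      ≈⟨ ⊛-congʳ (qPoch (i ℕ.+ k)) (qPoch²-invQPoch² i k) ⟩
    qPoch (i ℕ.+ k) ⊛ oneS
      ≈⟨ ⊛-identityʳ (qPoch (i ℕ.+ k)) ⟩
    qPoch (i ℕ.+ k) ∎

  qBinom-unique : ∀ i k Y → (qPoch i ⊛ qPoch k) ⊛ Y ≗ qPoch (i ℕ.+ k) → qBinom (i ℕ.+ k) i ≗ Y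
  qBinom-unique i k Y PY≗P = begin
    qBinom (i ℕ.+ k) i                   ≈⟨ ⊛-identityˡ (qBinom (i ℕ.+ k) i) ⟨
    oneS ⊛ qBinom (i ℕ.+ k) i            ≈⟨ ⊛-congˡ (qBinom (i ℕ.+ k) i) invP²·P² ⟨
    (I ⊛ P) ⊛ qBinom (i ℕ.+ k) i         ≈⟨ ⊛-assoc I P (qBinom (i ℕ.+ k) i) ⟩
    I ⊛ (P ⊛ qBinom (i ℕ.+ k) i)         ≈⟨ ⊛-congʳ I (qPoch²-qBinom i k) ⟩
    I ⊛ qPoch (i ℕ.+ k)                  ≈⟨ ⊛-congʳ I PY≗P ⟨
    I ⊛ (P ⊛ Y)                          ≈⟨ ⊛-assoc I P Y ⟨
    (I ⊛ P) ⊛ Y                          ≈⟨ ⊛-congˡ Y invP²·P² ⟩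
    oneS ⊛ Y                             ≈⟨ ⊛-identityˡ Y ⟩
    Y                                    ∎
    where
    P = qPoch i ⊛ qPoch k
    I = invQPoch i ⊛ invQPoch k
    invP²·P² : I ⊛ P ≗ oneS
    invP²·P² N = trans (⊛-comm I P N) (qPoch²-invQPoch² i k N)

  qBinom-zero : ∀ a → qBinom a 0 ≗ oneS
  qBinom-zero a = qBinom-unique 0 a oneS (λ N →
    trans (⊛-identityʳ (oneS ⊛ qPoch a) N) (⊛-identityˡ (qPoch a) N))

  qBinom-diagonal : ∀ a → qBinom a a ≗ oneS
  qBinom-diagonal a N = trans (cong (λ m → qBinom m a N) (sym (ℕ.+-identityʳ a)))
    (qBinom-unique a 0 oneS (λ M → trans (⊛-identityʳ (qPoch a ⊛ oneS) M)
      (trans (⊛-identityʳ (qPoch a) M) (cong (λ m → qPoch m M) (sym (ℕ.+-identityʳ a))))) N)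

  shift-oneMinusQ^ : ∀ j i → shift j (oneMinusQ^ i) ≗ δ j ⊖ δ (j ℕ.+ i)
  shift-oneMinusQ^ zero    i zero    = refl
  shift-oneMinusQ^ zero    i (suc N) = refl
  shift-oneMinusQ^ (suc j) i zero    = refl
  shift-oneMinusQ^ (suc j) i (suc N) = shift-oneMinusQ^ j i N

  qPoch-qBinom-sucˡ : ∀ i k {n} → i ℕ.+ k ≡ n →
    (qPoch (suc i) ⊛ qPoch k) ⊛ qBinom n i ≗ oneMinusQ^ (suc i) ⊛ qPoch n
  qPoch-qBinom-sucˡ i k refl = begin
    ((qPoch i ⊛ oneMinusQ^ (suc i)) ⊛ qPoch k) ⊛ qBinom (i ℕ.+ k) i
      ≈⟨ ⊛-congˡ (qBinom (i ℕ.+ k) i) (xy∙z≈y∙xz (qPoch i) (oneMinusQ^ (suc i)) (qPoch k)) ⟩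
    (oneMinusQ^ (suc i) ⊛ (qPoch i ⊛ qPoch k)) ⊛ qBinom (i ℕ.+ k) i
      ≈⟨ ⊛-assoc (oneMinusQ^ (suc i)) (qPoch i ⊛ qPoch k) (qBinom (i ℕ.+ k) i) ⟩
    oneMinusQ^ (suc i) ⊛ ((qPoch i ⊛ qPoch k) ⊛ qBinom (i ℕ.+ k) i)
      ≈⟨ ⊛-congʳ (oneMinusQ^ (suc i)) (qPoch²-qBinom i k) ⟩
    oneMinusQ^ (suc i) ⊛ qPoch (i ℕ.+ k) ∎

  qPoch-qBinom-sucʳ : ∀ i k {n} → i ℕ.+ k ≡ n →
    (qPoch i ⊛ qPoch (suc k)) ⊛ qBinom n i ≗ oneMinusQ^ (suc k) ⊛ qPoch n
  qPoch-qBinom-sucʳ i k refl = begin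
    (qPoch i ⊛ (qPoch k ⊛ oneMinusQ^ (suc k))) ⊛ qBinom (i ℕ.+ k) i
      ≈⟨ ⊛-congˡ (qBinom (i ℕ.+ k) i) (x∙yz≈z∙xy (qPoch i) (qPoch k) (oneMinusQ^ (suc k))) ⟩
    (oneMinusQ^ (suc k) ⊛ (qPoch i ⊛ qPoch k)) ⊛ qBinom (i ℕ.+ k) i
      ≈⟨ ⊛-assoc (oneMinusQ^ (suc k)) (qPoch i ⊛ qPoch k) (qBinom (i ℕ.+ k) i) ⟩
    oneMinusQ^ (suc k) ⊛ ((qPoch i ⊛ qPoch k) ⊛ qBinom (i ℕ.+ k) i)
      ≈⟨ ⊛-congʳ (oneMinusQ^ (suc k)) (qPoch²-qBinom i k) ⟩
    oneMinusQ^ (suc k) ⊛ qPoch (i ℕ.+ k) ∎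

  oneMinusQ^-⊕-shift : ∀ i j → oneMinusQ^ i ⊕ shift i (oneMinusQ^ j) ≗ oneMinusQ^ (i ℕ.+ j)
  oneMinusQ^-⊕-shift i j N rewrite shift-oneMinusQ^ i j N =
    solve 3 (λ o a b → (o :- a) :+ (a :- b) := o :- b) refl (oneS N) (δ i N) (δ (i ℕ.+ j) N)

  -- After multiplying by (q;q)_{m+1} (q;q)_{k+1}, both q-Pascal rules become
  -- (1 - q^{m+1}) + q^{m+1} (1 - q^{k+1}) = 1 - q^{m+k+2}, or its mirror image.
  qPascal₁ : ∀ {m A} → m ℕ.< A → qBinom (suc A) (suc m) ≗ qBinom A m ⊕ shift (suc m) (qBinom A (suc m))
  qPascal₁ {m} {A} m<A = split (trans (ℕ.+-suc m (A ∸ suc m)) (ℕ.m+[n∸m]≡n m<A))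
    where
    split : ∀ {k} → m ℕ.+ suc k ≡ A → qBinom (suc A) (suc m) ≗ qBinom A m ⊕ shift (suc m) (qBinom A (suc m))
    split {k} refl = qBinom-unique (suc m) (suc k) _ (begin
      P ⊛ (qBinom n m ⊕ shift (suc m) (qBinom n (suc m)))
        ≈⟨ ⊛-distribˡ-⊕ P (qBinom n m) (shift (suc m) (qBinom n (suc m))) ⟩
      P ⊛ qBinom n m ⊕ P ⊛ shift (suc m) (qBinom n (suc m))
        ≈⟨ ⊕-cong (qPoch-qBinom-sucˡ m (suc k) refl) (⊛-shift P (suc m) (qBinom n (suc m))) ⟩
      oneMinusQ^ (suc m) ⊛ qPoch n ⊕ shift (suc m) (P ⊛ qBinom n (suc m))
        ≈⟨ ⊕-congʳ (oneMinusQ^ (suc m) ⊛ qPoch n) (shift-cong (suc m) (qPoch-qBinom-sucʳ (suc m) k (sym (ℕ.+-suc m k)))) ⟩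
      oneMinusQ^ (suc m) ⊛ qPoch n ⊕ shift (suc m) (oneMinusQ^ (suc k) ⊛ qPoch n)
        ≈⟨ ⊛-shift-⊕ (oneMinusQ^ (suc m)) (suc m) (oneMinusQ^ (suc k)) (qPoch n) ⟩
      (oneMinusQ^ (suc m) ⊕ shift (suc m) (oneMinusQ^ (suc k))) ⊛ qPoch n
        ≈⟨ ⊛-congˡ (qPoch n) (oneMinusQ^-⊕-shift (suc m) (suc k)) ⟩
      oneMinusQ^ (suc n) ⊛ qPoch n
        ≈⟨ ⊛-comm (oneMinusQ^ (suc n)) (qPoch n) ⟩
      qPoch (suc n) ∎)
      where
      n = m ℕ.+ suc k
      P = qPoch (suc m) ⊛ qPoch (suc k)

  qPascal₂ : ∀ {m A} → m ℕ.< A → qBinom (suc A) (suc m) ≗ qBinom A (suc m) ⊕ shift (A ∸ m) (qBinom A m)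
  qPascal₂ {m} {A} m<A N = trans (split e N)
    (cong (λ j → qBinom A (suc m) N + shift j (qBinom A m) N) (trans (sym (ℕ.m+n∸m≡n m _)) (cong (_∸ m) e)))
    where
    e : m ℕ.+ suc (A ∸ suc m) ≡ A
    e = trans (ℕ.+-suc m (A ∸ suc m)) (ℕ.m+[n∸m]≡n m<A)
    split : ∀ {k} → m ℕ.+ suc k ≡ A → qBinom (suc A) (suc m) ≗ qBinom A (suc m) ⊕ shift (suc k) (qBinom A m)
    split {k} refl = qBinom-unique (suc m) (suc k) _ (begin
      P ⊛ (qBinom n (suc m) ⊕ shift (suc k) (qBinom n m))
        ≈⟨ ⊛-distribˡ-⊕ P (qBinom n (suc m)) (shift (suc k) (qBinom n m)) ⟩
      P ⊛ qBinom n (suc m) ⊕ P ⊛ shift (suc k) (qBinom n m)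
        ≈⟨ ⊕-cong (qPoch-qBinom-sucʳ (suc m) k (sym (ℕ.+-suc m k))) (⊛-shift P (suc k) (qBinom n m)) ⟩
      oneMinusQ^ (suc k) ⊛ qPoch n ⊕ shift (suc k) (P ⊛ qBinom n m)
        ≈⟨ ⊕-congʳ (oneMinusQ^ (suc k) ⊛ qPoch n) (shift-cong (suc k) (qPoch-qBinom-sucˡ m (suc k) refl)) ⟩
      oneMinusQ^ (suc k) ⊛ qPoch n ⊕ shift (suc k) (oneMinusQ^ (suc m) ⊛ qPoch n)
        ≈⟨ ⊛-shift-⊕ (oneMinusQ^ (suc k)) (suc k) (oneMinusQ^ (suc m)) (qPoch n) ⟩
      (oneMinusQ^ (suc k) ⊕ shift (suc k) (oneMinusQ^ (suc m))) ⊛ qPoch n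
        ≈⟨ ⊛-congˡ (qPoch n) (oneMinusQ^-⊕-shift (suc k) (suc m)) ⟩
      oneMinusQ^ (suc k ℕ.+ suc m) ⊛ qPoch n
        ≡⟨ cong (λ j → oneMinusQ^ j ⊛ qPoch n) (ℕ.+-comm (suc k) (suc m)) ⟩
      oneMinusQ^ (suc n) ⊛ qPoch n
        ≈⟨ ⊛-comm (oneMinusQ^ (suc n)) (qPoch n) ⟩
      qPoch (suc n) ∎)
      where
      n = m ℕ.+ suc k
      P = qPoch (suc m) ⊛ qPoch (suc k)

  coeffShift-cong : ∀ {f g} → f ≗ g → ∀ z → coeffShift f z ≡ coeffShift g z
  coeffShift-cong f≗g (+ n)     = f≗g n
  coeffShift-cong f≗g -[1+ n ]  = refl

  coeffShift-⊕ : ∀ f g z → coeffShift (f ⊕ g) z ≡ coeffShift f z + coeffShift g z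
  coeffShift-⊕ f g (+ n)     = refl
  coeffShift-⊕ f g -[1+ n ]  = refl

  coeffShift-zeroS : ∀ z → coeffShift zeroS z ≡ + 0
  coeffShift-zeroS (+ n)     = refl
  coeffShift-zeroS -[1+ n ]  = refl

  coeffShift-neg : ∀ f {z} → z ℤ.< + 0 → coeffShift f z ≡ + 0
  coeffShift-neg f { -[1+ n ]} _         = refl
  coeffShift-neg f {+ n}      (ℤ.+<+ ())

  +-∸-neg : ∀ {m n} → m ℕ.< n → + m - + n ℤ.< + 0
  +-∸-neg {m} {n} m<n rewrite ℤ.m-n≡m⊖n m n | ℤ.⊖-< m<n with n ∸ m | ℕ.m<n⇒0<n∸m m<n
  ... | suc _ | _ = ℤ.-<+

  coeffShift-shift : ∀ j f z → coeffShift (shift j f) z ≡ coeffShift f (z - + j)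
  coeffShift-shift j f (+ n) with ℕ.≤-<-connex j n
  ... | inj₁ j≤n rewrite shift-≥ j f j≤n | ℤ.m-n≡m⊖n n j | ℤ.⊖-≥ j≤n = refl
  ... | inj₂ n<j = trans (shift-< j f n<j) (sym (coeffShift-neg f (+-∸-neg n<j)))
  coeffShift-shift zero    f -[1+ n ] = refl
  coeffShift-shift (suc j) f -[1+ n ] = refl

  coeffShift-qBinom-> : ∀ {a b} → a ℕ.< b → ∀ z → coeffShift (qBinom a b) z ≡ + 0
  coeffShift-qBinom-> a<b z rewrite qBinom-> a<b = coeffShift-zeroS z

  qPascalℤ₁ : ∀ A k z → coeffShift (qBinomℤ (suc A) k) z
                      ≡ coeffShift (qBinomℤ A (k - + 1)) z + coeffShift (qBinomℤ A k) (z - k)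
  qPascalℤ₁ A -[1+ n ]   z =
    trans (coeffShift-zeroS z) (sym (cong₂ _+_ (coeffShift-zeroS z) (coeffShift-zeroS (z - -[1+ n ]))))
  qPascalℤ₁ A (+ zero)   z rewrite ℤ.+-identityʳ z =
    trans (coeffShift-cong (qBinom-zero (suc A)) z) (sym (trans (cong₂ _+_ (coeffShift-zeroS z)
      (coeffShift-cong (qBinom-zero A) z)) (ℤ.+-identityˡ (coeffShift oneS z))))
  qPascalℤ₁ A (+ suc m)  z with ℕ.<-cmp m A
  ... | tri< m<A _ _ = trans (coeffShift-cong (qPascal₁ m<A) z)
    (trans (coeffShift-⊕ (qBinom A m) _ z) (cong (_+_ (coeffShift (qBinom A m) z)) (coeffShift-shift (suc m) (qBinom A (suc m)) z)))
  ... | tri≈ _ refl _ = trans (coeffShift-cong (qBinom-diagonal (suc m)) z) (sym (trans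
    (cong₂ _+_ (coeffShift-cong (qBinom-diagonal m) z) (coeffShift-qBinom-> (ℕ.n<1+n m) (z - + suc m)))
    (ℤ.+-identityʳ (coeffShift oneS z))))
  ... | tri> _ _ A<m = trans (coeffShift-qBinom-> (s≤s A<m) z)
    (sym (cong₂ _+_ (coeffShift-qBinom-> A<m z) (coeffShift-qBinom-> (ℕ.m<n⇒m<1+n A<m) (z - + suc m))))

  qPascalℤ₂ : ∀ A k z → coeffShift (qBinomℤ (suc A) k) z
                      ≡ coeffShift (qBinomℤ A k) z + coeffShift (qBinomℤ A (k - + 1)) (z - (+ suc A - k))
  qPascalℤ₂ A -[1+ n ]   z =
    trans (coeffShift-zeroS z) (sym (cong₂ _+_ (coeffShift-zeroS z) (coeffShift-zeroS (z - (+ suc A - -[1+ n ])))))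
  qPascalℤ₂ A (+ zero)   z =
    trans (coeffShift-cong (qBinom-zero (suc A)) z) (sym (trans (cong₂ _+_ (coeffShift-cong (qBinom-zero A) z)
      (coeffShift-zeroS (z - (+ suc A - + 0)))) (ℤ.+-identityʳ (coeffShift oneS z))))
  qPascalℤ₂ A (+ suc m)  z with ℕ.<-cmp m A
  ... | tri< m<A _ _ = trans (coeffShift-cong (qPascal₂ m<A) z)
    (trans (coeffShift-⊕ (qBinom A (suc m)) _ z)
      (cong (_+_ (coeffShift (qBinom A (suc m)) z))
        (trans (coeffShift-shift (A ∸ m) (qBinom A m) z) (cong (λ d → coeffShift (qBinom A m) (z - d)) gap))))
    where
    gap : + (A ∸ m) ≡ + suc A - + suc m
    gap = sym (trans (ℤ.m-n≡m⊖n (suc A) (suc m)) (ℤ.⊖-≥ (ℕ.<⇒≤ (s≤s m<A))))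
  ... | tri≈ _ refl _ rewrite ℤ.+-inverseʳ (+ suc m) | ℤ.+-identityʳ z =
    trans (coeffShift-cong (qBinom-diagonal (suc m)) z) (sym (trans
      (cong₂ _+_ (coeffShift-qBinom-> (ℕ.n<1+n m) z) (coeffShift-cong (qBinom-diagonal m) z))
      (ℤ.+-identityˡ (coeffShift oneS z))))
  ... | tri> _ _ A<m = trans (coeffShift-qBinom-> (s≤s A<m) z)
    (sym (cong₂ _+_ (coeffShift-qBinom-> (ℕ.m<n⇒m<1+n A<m) z) (coeffShift-qBinom-> A<m (z - (+ suc A - + suc m)))))

  qPoch-suc-⊛-fixpoint : ∀ n f g → f ≗ g ⊕ shift (suc n) f → qPoch (suc n) ⊛ f ≗ qPoch n ⊛ g
  qPoch-suc-⊛-fixpoint n f g f≗g+shift = begin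
    (qPoch n ⊛ oneMinusQ^ (suc n)) ⊛ f  ≈⟨ ⊛-assoc (qPoch n) (oneMinusQ^ (suc n)) f ⟩
    qPoch n ⊛ (oneMinusQ^ (suc n) ⊛ f)  ≈⟨ ⊛-congʳ (qPoch n) (oneMinusQ^-⊛-fixpoint (suc n) f g f≗g+shift) ⟩
    qPoch n ⊛ g                        ∎

module RightHandSide where

  open import Defs
  open PowerSeries
  open GaussianBinomial
  open import Data.Nat as ℕ using (ℕ; zero; suc; z≤n; s≤s; _∸_; parity)
  import Data.Nat.Properties as ℕ
  open import Data.Integer as ℤ using (ℤ; +_; -[1+_]; _+_; _*_; -_; _-_; ∣_∣)
  import Data.Integer.Properties as ℤ
  open import Data.Integer.Solver using (module +-*-Solver)
  open import Data.Parity.Base using (Parity; 0ℙ; 1ℙ; _⁻¹)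
  import Data.Parity.Properties as ℙ
  open import Data.Product using (Σ; _,_)
  open import Data.Sum using (inj₁; inj₂)
  open import Relation.Binary.PropositionalEquality
  open import Relation.Nullary using (contradiction)
  open +-*-Solver

  sumSym-cong : ∀ M {g h} → (∀ r → g r ≡ h r) → sumSym M g ≡ sumSym M h
  sumSym-cong zero    g≡h = g≡h (+ 0)
  sumSym-cong (suc M) g≡h = cong₂ _+_ (cong₂ _+_ (sumSym-cong M g≡h) (g≡h _)) (g≡h _)

  sumSym-distrib-+ : ∀ M g h → sumSym M (λ r → g r + h r) ≡ sumSym M g + sumSym M h
  sumSym-distrib-+ zero    g h = refl
  sumSym-distrib-+ (suc M) g h rewrite sumSym-distrib-+ M g h =
    solve 6 (λ a b c d e f → ((a :+ b) :+ (c :+ d)) :+ (e :+ f) := ((a :+ c) :+ e) :+ ((b :+ d) :+ f)) refl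
      (sumSym M g) (sumSym M h) (g (+ suc M)) (h (+ suc M)) (g -[1+ M ]) (h -[1+ M ])

  sumSym-neg : ∀ M g → sumSym M (λ r → - g r) ≡ - sumSym M g
  sumSym-neg zero    g = refl
  sumSym-neg (suc M) g rewrite sumSym-neg M g =
    solve 3 (λ a b c → ((:- a) :+ (:- b)) :+ (:- c) := :- ((a :+ b) :+ c)) refl (sumSym M g) (g (+ suc M)) (g -[1+ M ])

  sumSym-distrib-- : ∀ M g h → sumSym M (λ r → g r - h r) ≡ sumSym M g - sumSym M h
  sumSym-distrib-- M g h = trans (sumSym-distrib-+ M g (λ r → - h r)) (cong (_+_ (sumSym M g)) (sumSym-neg M h))

  -[1+n]+1≡-n : ∀ n → -[1+ n ] + + 1 ≡ - + n
  -[1+n]+1≡-n n = trans (ℤ.[1+m]⊖[1+n]≡m⊖n 0 n) (trans (sym (ℤ.-m+n≡n⊖m n 0)) (ℤ.+-identityʳ (- + n)))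

  sumSym-telescope : ∀ M (Z : ℤ → ℤ) → sumSym M (λ r → Z r - Z (r + + 1)) ≡ Z (- + M) - Z (+ suc M)
  sumSym-telescope zero    Z = refl
  sumSym-telescope (suc M) Z rewrite sumSym-telescope M Z | -[1+n]+1≡-n M | ℕ.+-comm M 1 =
    solve 4 (λ a b c d → ((a :- b) :+ (b :- c)) :+ (d :- a) := d :- c) refl
      (Z (- + M)) (Z (+ suc M)) (Z (+ suc (suc M))) (Z -[1+ M ])

  sumSym-truncate : ∀ {M M′} g → M ℕ.≤ M′ → (∀ r → M ℕ.< ∣ r ∣ → g r ≡ + 0) → sumSym M′ g ≡ sumSym M g
  sumSym-truncate {M} {M′} g M≤M′ g≡0 rewrite sym (ℕ.m∸n+n≡m M≤M′) = go (M′ ∸ M)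
    where
    go : ∀ R → sumSym (R ℕ.+ M) g ≡ sumSym M g
    go zero    = refl
    go (suc R) rewrite go R | g≡0 (+ suc (R ℕ.+ M)) (s≤s (ℕ.m≤n+m M R))
      | g≡0 -[1+ (R ℕ.+ M) ] (s≤s (ℕ.m≤n+m M R)) = trans (ℤ.+-identityʳ _) (ℤ.+-identityʳ _)

  sumSym-zero : ∀ M g → (∀ r → g r ≡ + 0) → sumSym M g ≡ + 0
  sumSym-zero zero    g g≡0 = g≡0 (+ 0)
  sumSym-zero (suc M) g g≡0 rewrite sumSym-zero M g g≡0 | g≡0 (+ suc M) | g≡0 -[1+ M ] = refl

  sumSym-single : ∀ M g → (∀ r → r ≢ + 0 → g r ≡ + 0) → sumSym M g ≡ g (+ 0)
  sumSym-single zero    g g≡0 = refl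
  sumSym-single (suc M) g g≡0 rewrite sumSym-single M g g≡0 | g≡0 (+ suc M) (λ ()) | g≡0 -[1+ M ] (λ ()) =
    trans (ℤ.+-identityʳ _) (ℤ.+-identityʳ _)

  exponent : ℤ → ℤ
  exponent r = r * (+ 3 * r + + 2)

  private
    pos-3*[m*n] : ∀ m n → + (3 ℕ.* (m ℕ.* n)) ≡ + 3 * (+ m * + n)
    pos-3*[m*n] m n = trans (ℤ.pos-* 3 (m ℕ.* n)) (cong (+ 3 *_) (ℤ.pos-* m n))

  exponent-≥-∣∣ : ∀ r → Σ ℕ λ t → exponent r ≡ + ∣ r ∣ + + t
  exponent-≥-∣∣ (+ n) = 3 ℕ.* (n ℕ.* n) ℕ.+ n , (begin
    + n * (+ 3 * + n + + 2)
      ≡⟨ solve 1 (λ x → x :* (con (+ 3) :* x :+ con (+ 2)) := x :+ (con (+ 3) :* (x :* x) :+ x)) refl (+ n) ⟩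
    + n + (+ 3 * (+ n * + n) + + n)
      ≡⟨ cong (λ s → + n + (s + + n)) (pos-3*[m*n] n n) ⟨
    + n + (+ (3 ℕ.* (n ℕ.* n)) + + n)
      ≡⟨ cong (_+_ (+ n)) (ℤ.pos-+ (3 ℕ.* (n ℕ.* n)) n) ⟨
    + n + + (3 ℕ.* (n ℕ.* n) ℕ.+ n) ∎)
    where open ≡-Reasoning
  exponent-≥-∣∣ -[1+ n ] = 3 ℕ.* (suc n ℕ.* n) , (begin
    -[1+ n ] * (+ 3 * -[1+ n ] + + 2)
      ≡⟨ solve 1 (λ x → (:- (con (+ 1) :+ x)) :* (con (+ 3) :* (:- (con (+ 1) :+ x)) :+ con (+ 2))
                      := (con (+ 1) :+ x) :+ con (+ 3) :* ((con (+ 1) :+ x) :* x)) refl (+ n) ⟩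
    + suc n + + 3 * (+ suc n * + n)
      ≡⟨ cong (_+_ (+ suc n)) (pos-3*[m*n] (suc n) n) ⟨
    + suc n + + (3 ℕ.* (suc n ℕ.* n)) ∎)
    where open ≡-Reasoning

  +-suc≡0⇒<0 : ∀ z u → z + + suc u ≡ + 0 → z ℤ.< + 0
  +-suc≡0⇒<0 (+ n)    u eq = contradiction (ℤ.+-injective eq) (ℕ.m+1+n≢0 n)
  +-suc≡0⇒<0 -[1+ n ] u _  = ℤ.-<+

  exponent-beyond : ∀ {M j} r → M ℕ.< ∣ r ∣ ℕ.+ j → (+ M - exponent r) - + j ℤ.< + 0
  exponent-beyond {M} {j} r M<r+j with exponent-≥-∣∣ r
  ... | t , e≡ rewrite e≡ = +-suc≡0⇒<0 _ (d ℕ.+ t) (begin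
    (+ M - (+ ∣ r ∣ + + t)) - + j + + suc (d ℕ.+ t)
      ≡⟨ cong (λ s → (+ M - (+ ∣ r ∣ + + t)) - + j + s) (ℤ.pos-+ (suc d) t) ⟩
    (+ M - (+ ∣ r ∣ + + t)) - + j + (+ suc d + + t)
      ≡⟨ solve 5 (λ m a t j d → ((m :- (a :+ t)) :- j) :+ (d :+ t) := (m :+ d) :- (a :+ j))
           refl (+ M) (+ ∣ r ∣) (+ t) (+ j) (+ suc d) ⟩
    (+ M + + suc d) - (+ ∣ r ∣ + + j)
      ≡⟨ cong₂ _-_ (sym (ℤ.pos-+ M (suc d))) (sym (ℤ.pos-+ ∣ r ∣ j)) ⟩
    + (M ℕ.+ suc d) - + (∣ r ∣ ℕ.+ j)
      ≡⟨ cong (λ s → + s - + (∣ r ∣ ℕ.+ j)) gap ⟩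
    + (∣ r ∣ ℕ.+ j) - + (∣ r ∣ ℕ.+ j)
      ≡⟨ ℤ.+-inverseʳ (+ (∣ r ∣ ℕ.+ j)) ⟩
    + 0 ∎)
    where
    open ≡-Reasoning
    d = ∣ r ∣ ℕ.+ j ∸ suc M
    gap : M ℕ.+ suc d ≡ ∣ r ∣ ℕ.+ j
    gap = trans (ℕ.+-suc M d) (ℕ.m+[n∸m]≡n M<r+j)

  paritySign : Parity → ℤ
  paritySign 0ℙ = + 1
  paritySign 1ℙ = - + 1

  signℤ-parity : ∀ r → signℤ r ≡ paritySign (parity ∣ r ∣)
  signℤ-parity r = go ∣ r ∣
    where
    go : ∀ n → (- + 1) ℤ.^ n ≡ paritySign (parity n)
    go zero          = refl
    go (suc zero)    = refl
    go (suc (suc n)) = trans (sym (ℤ.*-assoc (- + 1) (- + 1) ((- + 1) ℤ.^ n))) (trans (ℤ.*-identityˡ _) (go n))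

  parity-+1 : ∀ r → parity ∣ r + + 1 ∣ ≡ (parity ∣ r ∣) ⁻¹
  parity-+1 (+ n) rewrite ℕ.+-comm n 1 = trans (sym (ℙ.⁻¹-involutive (parity (suc n)))) (cong _⁻¹ (ℙ.suc-homo-⁻¹ n))
  parity-+1 -[1+ n ] rewrite -[1+n]+1≡-n n | ℤ.∣-i∣≡∣i∣ (+ n) = sym (ℙ.suc-homo-⁻¹ n)

  -- The lower index of the paper's summand: n - 3r + (-1)^r - 1 on the diagonal a = b = n.
  lowerIndex : Parity → ℕ → ℕ → ℤ → ℤ
  lowerIndex 0ℙ a b r = + b - + 3 * r
  lowerIndex 1ℙ a b r = + a - + 3 * r - + 2

  -- Coefficients of Σ_r (-1)^r q^{r(3r+2)} F r; since r(3r+2) ≥ |r|, only |r| ≤ M reach q^M.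
  thetaSum : (ℤ → Series) → Series
  thetaSum F M = sumSym M (λ r → signℤ r * coeffShift (F r) (+ M - exponent r))

  rhs : ℕ → ℕ → Series
  rhs a b = thetaSum (λ r → qBinomℤ (a ℕ.+ b) (lowerIndex (parity ∣ r ∣) a b r))

  thetaSum-extend : ∀ F {M M′} → M ℕ.≤ M′ →
    sumSym M′ (λ r → signℤ r * coeffShift (F r) (+ M - exponent r)) ≡ thetaSum F M
  thetaSum-extend F {M} M≤M′ = sumSym-truncate _ M≤M′ (λ r M<r →
    trans (cong (signℤ r *_) (coeffShift-neg (F r) (below r M<r))) (ℤ.*-zeroʳ (signℤ r)))
    where
    below : ∀ r → M ℕ.< ∣ r ∣ → + M - exponent r ℤ.< + 0
    below r M<r = subst (λ z → z ℤ.< + 0) (ℤ.+-identityʳ (+ M - exponent r))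
      (exponent-beyond r (subst (M ℕ.<_) (sym (ℕ.+-identityʳ ∣ r ∣)) M<r))

  shift-thetaSum : ∀ j F M →
    shift j (thetaSum F) M ≡ sumSym M (λ r → signℤ r * coeffShift (F r) ((+ M - exponent r) - + j))
  shift-thetaSum j F M with ℕ.≤-<-connex j M
  ... | inj₁ j≤M rewrite shift-≥ j (thetaSum F) j≤M =
    trans (sym (thetaSum-extend F (ℕ.m∸n≤m M j))) (sumSym-cong M (λ r → cong (λ z → signℤ r * coeffShift (F r) z)
      (trans (cong (_- exponent r) (sym (trans (ℤ.m-n≡m⊖n M j) (ℤ.⊖-≥ j≤M))))
        (solve 3 (λ m j x → (m :- j) :- x := (m :- x) :- j) refl (+ M) (+ j) (exponent r)))))
  ... | inj₂ M<j rewrite shift-< j (thetaSum F) M<j = sym (sumSym-zero M _ (λ r →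
    trans (cong (signℤ r *_) (coeffShift-neg (F r) (exponent-beyond r (ℕ.<-≤-trans M<j (ℕ.m≤n+m j ∣ r ∣)))))
      (ℤ.*-zeroʳ (signℤ r))))

  qBinomℤ-four-term : ∀ A k z → coeffShift (qBinomℤ (suc (suc A)) k) z ≡
    coeffShift (qBinomℤ (suc A) k) z + coeffShift (qBinomℤ (suc A) (k - + 1)) z
    - coeffShift (qBinomℤ A (k - + 1)) z + coeffShift (qBinomℤ A (k - + 1)) (z - + suc A)
  qBinomℤ-four-term A k z rewrite qPascalℤ₁ (suc A) k z | qPascalℤ₁ A k z | qPascalℤ₂ A k (z - k)
    | solve 3 (λ z k a → (z :- k) :- (a :- k) := z :- a) refl z k (+ suc A) =
    solve 4 (λ y v w u → y :+ (v :+ w) := (((u :+ v) :+ y) :- u) :+ w) refl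
      (coeffShift (qBinomℤ (suc A) (k - + 1)) z) (coeffShift (qBinomℤ A k) (z - k))
      (coeffShift (qBinomℤ A (k - + 1)) (z - + suc A)) (coeffShift (qBinomℤ A (k - + 1)) z)

  private
    scale : ∀ s x y u w → s * (x + y - u + w) ≡ s * x + s * y - s * u + s * w
    scale = solve 5 (λ s x y u w → s :* (x :+ y :- u :+ w) := s :* x :+ s :* y :- s :* u :+ s :* w) refl

    rhs-recurrence-term : ∀ a b p r s z →
      s * coeffShift (qBinomℤ (suc a ℕ.+ suc b) (lowerIndex p (suc a) (suc b) r)) z ≡
      s * coeffShift (qBinomℤ (a ℕ.+ suc b) (lowerIndex p a (suc b) r)) z
      + s * coeffShift (qBinomℤ (suc a ℕ.+ b) (lowerIndex p (suc a) b r)) z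
      - s * coeffShift (qBinomℤ (a ℕ.+ b) (lowerIndex p a b r)) z
      + s * coeffShift (qBinomℤ (a ℕ.+ b) (lowerIndex p a b r)) (z - + suc (a ℕ.+ b))
    rhs-recurrence-term a b 0ℙ r s z rewrite ℕ.+-suc a b
      | qBinomℤ-four-term (a ℕ.+ b) (+ suc b - + 3 * r) z
      | solve 2 (λ b r → con (+ 1) :+ b :- con (+ 3) :* r :- con (+ 1) := b :- con (+ 3) :* r) refl (+ b) r =
      scale s _ _ _ _
    rhs-recurrence-term a b 1ℙ r s z rewrite ℕ.+-suc a b
      | qBinomℤ-four-term (a ℕ.+ b) (+ suc a - + 3 * r - + 2) z
      | solve 2 (λ a r → con (+ 1) :+ a :- con (+ 3) :* r :- con (+ 2) :- con (+ 1) := a :- con (+ 3) :* r :- con (+ 2))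
          refl (+ a) r =
      trans (scale s x y u w) (cong (λ t → t - s * u + s * w) (ℤ.+-comm (s * x) (s * y)))
      where
      A = a ℕ.+ b
      x = coeffShift (qBinomℤ (suc A) (+ suc a - + 3 * r - + 2)) z
      y = coeffShift (qBinomℤ (suc A) (+ a - + 3 * r - + 2)) z
      u = coeffShift (qBinomℤ A (+ a - + 3 * r - + 2)) z
      w = coeffShift (qBinomℤ A (+ a - + 3 * r - + 2)) (z - + suc A)

  rhs-recurrence : ∀ a b →
    rhs (suc a) (suc b) ≗ rhs a (suc b) ⊕ rhs (suc a) b ⊖ rhs a b ⊕ shift (suc (a ℕ.+ b)) (rhs a b)
  rhs-recurrence a b M = begin
    rhs (suc a) (suc b) M
      ≡⟨ sumSym-cong M (λ r → rhs-recurrence-term a b (parity ∣ r ∣) r (signℤ r) (+ M - exponent r)) ⟩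
    sumSym M (λ r → X r + Y r - U r + W r)
      ≡⟨ sumSym-distrib-+ M (λ r → X r + Y r - U r) W ⟩
    sumSym M (λ r → X r + Y r - U r) + sumSym M W
      ≡⟨ cong₂ _+_ (trans (sumSym-distrib-- M (λ r → X r + Y r) U) (cong (_- sumSym M U) (sumSym-distrib-+ M X Y)))
                   (sym (shift-thetaSum (suc (a ℕ.+ b)) _ M)) ⟩
    rhs a (suc b) M + rhs (suc a) b M - rhs a b M + shift (suc (a ℕ.+ b)) (rhs a b) M ∎
    where
    open ≡-Reasoning
    term : ℕ → ℕ → ℤ → ℤ → ℤ
    term a′ b′ r z = signℤ r * coeffShift (qBinomℤ (a′ ℕ.+ b′) (lowerIndex (parity ∣ r ∣) a′ b′ r)) z
    X Y U W : ℤ → ℤ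
    X r = term a (suc b) r (+ M - exponent r)
    Y r = term (suc a) b r (+ M - exponent r)
    U r = term a b r (+ M - exponent r)
    W r = term a b r (+ M - exponent r - + suc (a ℕ.+ b))

  sumSym-telescoping : ∀ M g h (Z : ℤ → ℤ) → (∀ r → g r - h r ≡ Z r - Z (r + + 1)) →
    Z (- + M) ≡ + 0 → Z (+ suc M) ≡ + 0 → sumSym M g ≡ sumSym M h
  sumSym-telescoping M g h Z step left right = ℤ.i-j≡0⇒i≡j (sumSym M g) (sumSym M h) (begin
    sumSym M g - sumSym M h            ≡⟨ sumSym-distrib-- M g h ⟨
    sumSym M (λ r → g r - h r)          ≡⟨ sumSym-cong M step ⟩
    sumSym M (λ r → Z r - Z (r + + 1))  ≡⟨ sumSym-telescope M Z ⟩
    Z (- + M) - Z (+ suc M)             ≡⟨ cong₂ _-_ left right ⟩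
    + 0                                 ∎)
    where open ≡-Reasoning

  whenEven : Parity → ℤ → ℤ
  whenEven 0ℙ x = x
  whenEven 1ℙ _ = + 0

  whenOdd : Parity → ℤ → ℤ
  whenOdd 0ℙ _ = + 0
  whenOdd 1ℙ x = x

  private
    pos-quadratic : ∀ k M n → + (3 ℕ.* (M ℕ.* M) ℕ.+ (k ℕ.* M ℕ.+ n)) ≡ + 3 * (+ M * + M) + (+ k * + M + + n)
    pos-quadratic k M n = trans (ℤ.pos-+ (3 ℕ.* (M ℕ.* M)) (k ℕ.* M ℕ.+ n))
      (cong₂ _+_ (pos-3*[m*n] M M) (trans (ℤ.pos-+ (k ℕ.* M) n) (cong (_+ + n) (ℤ.pos-* k M))))

    coeffShift-vanishes : ∀ f z k M n → z + (+ 1 + (+ 3 * (+ M * + M) + (+ k * + M + + n))) ≡ + 0 → coeffShift f z ≡ + 0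
    coeffShift-vanishes f z k M n eq = coeffShift-neg f (+-suc≡0⇒<0 z _ (trans (cong (λ u → z + (+ 1 + u)) (pos-quadratic k M n)) eq))

    whenEven-zero : ∀ p {x} → x ≡ + 0 → whenEven p x ≡ + 0
    whenEven-zero 0ℙ x≡0 = x≡0
    whenEven-zero 1ℙ _   = refl

    whenOdd-zero : ∀ p {x} → x ≡ + 0 → whenOdd p x ≡ + 0
    whenOdd-zero 0ℙ _   = refl
    whenOdd-zero 1ℙ x≡0 = x≡0

  rhs-diagonal-step : ∀ c → rhs (suc c) (suc c) ≗ rhs (suc c) c
  rhs-diagonal-step c M = sumSym-telescoping M _ _ Z step
    (whenEven-zero (parity ∣ - + M ∣) left) (whenEven-zero (parity (suc M)) right)
    where
    A = suc (c ℕ.+ c)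
    κ z : ℤ → ℤ
    κ r = + suc c - + 3 * r
    z r = + M - exponent r - κ r
    Y Z : ℤ → ℤ
    Y r = coeffShift (qBinomℤ A (κ r)) (z r)
    Z r = whenEven (parity ∣ r ∣) (Y r)
    left : Y (- + M) ≡ + 0
    left = coeffShift-vanishes (qBinomℤ A (κ (- + M))) (z (- + M)) 0 M c (solve 2 (λ m c →
      m :- (:- m) :* (con (+ 3) :* (:- m) :+ con (+ 2)) :- (con (+ 1) :+ c :- con (+ 3) :* (:- m))
      :+ (con (+ 1) :+ (con (+ 3) :* (m :* m) :+ (con (+ 0) :* m :+ c))) := con (+ 0)) refl (+ M) (+ c))
    right : Y (+ suc M) ≡ + 0
    right = coeffShift-vanishes (qBinomℤ A (κ (+ suc M))) (z (+ suc M)) 4 M (2 ℕ.+ c) (solve 2 (λ m c →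
      m :- (con (+ 1) :+ m) :* (con (+ 3) :* (con (+ 1) :+ m) :+ con (+ 2)) :- (con (+ 1) :+ c :- con (+ 3) :* (con (+ 1) :+ m))
      :+ (con (+ 1) :+ (con (+ 3) :* (m :* m) :+ (con (+ 4) :* m :+ (con (+ 2) :+ c)))) := con (+ 0)) refl (+ M) (+ c))
    step : ∀ r →
      signℤ r * coeffShift (qBinomℤ (suc c ℕ.+ suc c) (lowerIndex (parity ∣ r ∣) (suc c) (suc c) r)) (+ M - exponent r)
      - signℤ r * coeffShift (qBinomℤ (suc c ℕ.+ c) (lowerIndex (parity ∣ r ∣) (suc c) c r)) (+ M - exponent r)
      ≡ Z r - Z (r + + 1)
    step r rewrite ℕ.+-suc c c | signℤ-parity r | parity-+1 r with parity ∣ r ∣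
    ... | 0ℙ rewrite qPascalℤ₁ A (κ r) (+ M - exponent r)
          | solve 2 (λ c r → con (+ 1) :+ c :- con (+ 3) :* r :- con (+ 1) := c :- con (+ 3) :* r) refl (+ c) r =
      solve 2 (λ u v → con (+ 1) :* (u :+ v) :- con (+ 1) :* u := v :- con (+ 0)) refl
        (coeffShift (qBinomℤ A (+ c - + 3 * r)) (+ M - exponent r)) (Y r)
    ... | 1ℙ rewrite qPascalℤ₂ A (κ r - + 2) (+ M - exponent r)
          | solve 2 (λ c r → con (+ 1) :+ c :- con (+ 3) :* r :- con (+ 2) :- con (+ 1)
                            := con (+ 1) :+ c :- con (+ 3) :* (r :+ con (+ 1))) refl (+ c) r
          | solve 3 (λ m c r →
                m :- r :* (con (+ 3) :* r :+ con (+ 2))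
                  :- (con (+ 2) :+ (c :+ c) :- (con (+ 1) :+ c :- con (+ 3) :* r :- con (+ 2)))
                := m :- (r :+ con (+ 1)) :* (con (+ 3) :* (r :+ con (+ 1)) :+ con (+ 2))
                  :- (con (+ 1) :+ c :- con (+ 3) :* (r :+ con (+ 1))))
              refl (+ M) (+ c) r =
      solve 2 (λ u v → (:- con (+ 1)) :* (u :+ v) :- (:- con (+ 1)) :* u := con (+ 0) :- v) refl
        (coeffShift (qBinomℤ A (κ r - + 2)) (+ M - exponent r)) (Y (r + + 1))

  rhs-offset-step : ∀ c → rhs (4 ℕ.+ c) c ≗ rhs (3 ℕ.+ c) c
  rhs-offset-step c M = sumSym-telescoping M _ _ Z step
    (whenOdd-zero (parity ∣ - + M ∣) (cong -_ left)) (whenOdd-zero (parity (suc M)) (cong -_ right))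
    where
    A = 3 ℕ.+ (c ℕ.+ c)
    κ z : ℤ → ℤ
    κ r = + (4 ℕ.+ c) - + 3 * r - + 2
    z r = + M - exponent r - κ r
    W Z : ℤ → ℤ
    W r = coeffShift (qBinomℤ A (κ r)) (z r)
    Z r = whenOdd (parity ∣ r ∣) (- W r)
    left : W (- + M) ≡ + 0
    left = coeffShift-vanishes (qBinomℤ A (κ (- + M))) (z (- + M)) 0 M (1 ℕ.+ c) (solve 2 (λ m c →
      m :- (:- m) :* (con (+ 3) :* (:- m) :+ con (+ 2)) :- (con (+ 4) :+ c :- con (+ 3) :* (:- m) :- con (+ 2))
      :+ (con (+ 1) :+ (con (+ 3) :* (m :* m) :+ (con (+ 0) :* m :+ (con (+ 1) :+ c)))) := con (+ 0)) refl (+ M) (+ c))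
    right : W (+ suc M) ≡ + 0
    right = coeffShift-vanishes (qBinomℤ A (κ (+ suc M))) (z (+ suc M)) 4 M (3 ℕ.+ c) (solve 2 (λ m c →
      m :- (con (+ 1) :+ m) :* (con (+ 3) :* (con (+ 1) :+ m) :+ con (+ 2)) :- (con (+ 4) :+ c :- con (+ 3) :* (con (+ 1) :+ m) :- con (+ 2))
      :+ (con (+ 1) :+ (con (+ 3) :* (m :* m) :+ (con (+ 4) :* m :+ (con (+ 3) :+ c)))) := con (+ 0)) refl (+ M) (+ c))
    step : ∀ r →
      signℤ r * coeffShift (qBinomℤ (4 ℕ.+ c ℕ.+ c) (lowerIndex (parity ∣ r ∣) (4 ℕ.+ c) c r)) (+ M - exponent r)
      - signℤ r * coeffShift (qBinomℤ (3 ℕ.+ c ℕ.+ c) (lowerIndex (parity ∣ r ∣) (3 ℕ.+ c) c r)) (+ M - exponent r)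
      ≡ Z r - Z (r + + 1)
    step r rewrite signℤ-parity r | parity-+1 r with parity ∣ r ∣
    ... | 0ℙ rewrite qPascalℤ₂ A (+ c - + 3 * r) (+ M - exponent r)
          | solve 2 (λ c r → c :- con (+ 3) :* r :- con (+ 1) := con (+ 4) :+ c :- con (+ 3) :* (r :+ con (+ 1)) :- con (+ 2))
              refl (+ c) r
          | solve 3 (λ m c r → m :- r :* (con (+ 3) :* r :+ con (+ 2)) :- (con (+ 4) :+ (c :+ c) :- (c :- con (+ 3) :* r))
                            := m :- (r :+ con (+ 1)) :* (con (+ 3) :* (r :+ con (+ 1)) :+ con (+ 2))
                               :- (con (+ 4) :+ c :- con (+ 3) :* (r :+ con (+ 1)) :- con (+ 2)))
              refl (+ M) (+ c) r =
      solve 2 (λ u v → con (+ 1) :* (u :+ v) :- con (+ 1) :* u := con (+ 0) :- (:- v)) refl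
        (coeffShift (qBinomℤ A (+ c - + 3 * r)) (+ M - exponent r)) (W (r + + 1))
    ... | 1ℙ rewrite qPascalℤ₁ A (κ r) (+ M - exponent r)
          | solve 2 (λ c r → con (+ 4) :+ c :- con (+ 3) :* r :- con (+ 2) :- con (+ 1)
                            := con (+ 3) :+ c :- con (+ 3) :* r :- con (+ 2)) refl (+ c) r =
      solve 2 (λ u v → (:- con (+ 1)) :* (u :+ v) :- (:- con (+ 1)) :* u := (:- v) :- con (+ 0)) refl
        (coeffShift (qBinomℤ A (+ (3 ℕ.+ c) - + 3 * r - + 2)) (+ M - exponent r)) (W r)

  private
    qBinomℤ-neg : ∀ A {k} → k ℤ.< + 0 → qBinomℤ A k ≡ zeroS
    qBinomℤ-neg A { -[1+ _ ]} _         = refl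
    qBinomℤ-neg A {+ _}       (ℤ.+<+ ())

    even-negative-index : ∀ n → + 0 - + 3 * -[1+ n ] ≡ + (3 ℕ.* suc n)
    even-negative-index n = trans (solve 1 (λ x → con (+ 0) :- con (+ 3) :* (:- x) := con (+ 3) :* x) refl (+ suc n))
      (sym (ℤ.pos-* 3 (suc n)))

    odd-negative-index : ∀ a n → + a - + 3 * -[1+ n ] - + 2 ≡ + suc (a ℕ.+ 3 ℕ.* n)
    odd-negative-index a n = trans
      (solve 2 (λ a x → a :- con (+ 3) :* (:- (con (+ 1) :+ x)) :- con (+ 2) := con (+ 1) :+ (a :+ con (+ 3) :* x)) refl (+ a) (+ n))
      (cong (λ t → + 1 + (+ a + t)) (sym (ℤ.pos-* 3 n)))

    odd-positive-index : ∀ a n → + a - + 3 * + suc n - + 2 ≡ + a - + (3 ℕ.* suc n ℕ.+ 2)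
    odd-positive-index a n rewrite ℤ.pos-+ (3 ℕ.* suc n) 2 | ℤ.pos-* 3 (suc n) =
      solve 3 (λ a x y → a :- x :- y := a :- (x :+ y)) refl (+ a) (+ 3 * + suc n) (+ 2)

    -- Only r = 0 contributes: every other lower index is negative or exceeds a.
    lowerIndex-out-of-range : ∀ {a} → a ℕ.≤ 4 → ∀ r → r ≢ + 0 →
      qBinomℤ a (lowerIndex (parity ∣ r ∣) a 0 r) ≡ zeroS
    lowerIndex-out-of-range a≤4 (+ zero) r≢0 = contradiction refl r≢0
    lowerIndex-out-of-range {a} a≤4 (+ suc n) _ with parity (suc n)
    ... | 0ℙ = qBinomℤ-neg a (subst (λ k → + 0 - k ℤ.< + 0) (ℤ.pos-* 3 (suc n)) (+-∸-neg (s≤s z≤n)))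
    ... | 1ℙ rewrite odd-positive-index a n =
      qBinomℤ-neg a (+-∸-neg (ℕ.<-≤-trans (s≤s a≤4) (ℕ.+-monoˡ-≤ 2 (ℕ.*-monoʳ-≤ 3 (s≤s z≤n)))))
    lowerIndex-out-of-range {a} a≤4 -[1+ zero ] _ rewrite odd-negative-index a 0 =
      qBinom-> (s≤s (ℕ.m≤m+n a (3 ℕ.* 0)))
    lowerIndex-out-of-range {a} a≤4 -[1+ suc m ] _ with parity m
    ... | 0ℙ rewrite even-negative-index (suc m) =
      qBinom-> (ℕ.<-≤-trans (s≤s a≤4) (ℕ.≤-trans (ℕ.n≤1+n 5) (ℕ.*-monoʳ-≤ 3 (s≤s (s≤s z≤n)))))
    ... | 1ℙ rewrite odd-negative-index a (suc m) = qBinom-> (s≤s (ℕ.m≤m+n a (3 ℕ.* suc m)))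

  rhs-zero : ∀ a → a ℕ.≤ 4 → rhs a 0 ≗ oneS
  rhs-zero a a≤4 M = begin
    rhs a 0 M
      ≡⟨ sumSym-single M _ vanish ⟩
    + 1 * coeffShift (qBinom (a ℕ.+ 0) 0) (+ M + + 0)
      ≡⟨ ℤ.*-identityˡ _ ⟩
    coeffShift (qBinom (a ℕ.+ 0) 0) (+ M + + 0)
      ≡⟨ cong (coeffShift (qBinom (a ℕ.+ 0) 0)) (ℤ.+-identityʳ (+ M)) ⟩
    qBinom (a ℕ.+ 0) 0 M
      ≡⟨ qBinom-zero (a ℕ.+ 0) M ⟩
    oneS M ∎
    where
    open ≡-Reasoning
    vanish : ∀ r → r ≢ + 0 →
      signℤ r * coeffShift (qBinomℤ (a ℕ.+ 0) (lowerIndex (parity ∣ r ∣) a 0 r)) (+ M - exponent r) ≡ + 0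
    vanish r r≢0 rewrite ℕ.+-identityʳ a | lowerIndex-out-of-range a≤4 r r≢0 =
      trans (cong (signℤ r *_) (coeffShift-zeroS (+ M - exponent r))) (ℤ.*-zeroʳ (signℤ r))

  lowerIndex-diagonal : ∀ n r → lowerIndex (parity ∣ r ∣) n n r ≡ + n - + 3 * r + signℤ r - + 1
  lowerIndex-diagonal n r rewrite signℤ-parity r with parity ∣ r ∣
  ... | 0ℙ = solve 2 (λ n r → n :- con (+ 3) :* r := n :- con (+ 3) :* r :+ con (+ 1) :- con (+ 1)) refl (+ n) r
  ... | 1ℙ = solve 2 (λ n r → n :- con (+ 3) :* r :- con (+ 2) := n :- con (+ 3) :* r :+ (:- con (+ 1)) :- con (+ 1)) refl (+ n) r

  rhs-diagonal : ∀ n → rhs n n ≗ rhsCoeff n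
  rhs-diagonal n N = sumSym-cong N (λ r → cong₂ (λ A k → signℤ r * coeffShift (qBinomℤ A k) (+ N - exponent r))
    (cong (n ℕ.+_) (sym (ℕ.+-identityʳ n))) (lowerIndex-diagonal n r))

module CylindricPairs where

  open import Defs
  open import Data.Nat as ℕ using (ℕ; zero; suc; z≤n; s≤s; _≤_; _<_; _+_; _∸_; pred)
  import Data.Nat.Properties as ℕ
  open import Data.Vec as Vec using (Vec; []; _∷_; _∷ʳ_)
  import Data.Vec.Properties as VecP
  open import Data.Product using (_×_; _,_; proj₁; proj₂)
  open import Data.Sum using (_⊎_; inj₁; inj₂)
  open import Relation.Binary.PropositionalEquality
  open import Relation.Nullary using (Dec; ¬_; _×-dec_; _⊎-dec_)
  open import Function using (_⇔_; mk⇔)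

  Pair : ℕ → ℕ → Set
  Pair a b = Vec ℕ a × Vec ℕ b

  IsCylindric : (a b k : ℕ) → Pair a b → Set
  IsCylindric a b k (u , w) =
    IsPartition u × IsPartition w × (∀ j → part w j ≤ part u j) × (∀ j → part u (j + 4) ≤ part w j) ×
    (vsum u + vsum w ≡ k)

  IsCP40⇔IsCylindric : ∀ n k p → IsCP40 n k p ⇔ IsCylindric n n k p
  IsCP40⇔IsCylindric n k (u , w) = mk⇔
    (λ (pu , pw , w≤u , u≤w , size) → pu , pw , (λ j → w≤u-+0 j (ℕ.+-identityʳ j) (w≤u j)) , u≤w , size)
    (λ (pu , pw , w≤u , u≤w , size) → pu , pw , (λ j → w≤u-+0 j (sym (ℕ.+-identityʳ j)) (w≤u j)) , u≤w , size)
    where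
    w≤u-+0 : ∀ j {i i′} → i ≡ i′ → part w i ≤ part u j → part w i′ ≤ part u j
    w≤u-+0 j i≡i′ = subst (λ i → part w i ≤ part u j) i≡i′

  IsCylindric-resp : ∀ {a b a′ b′ k} (u : Vec ℕ a) (w : Vec ℕ b) (u′ : Vec ℕ a′) (w′ : Vec ℕ b′) →
    (∀ j → part u′ j ≡ part u j) → (∀ j → part w′ j ≡ part w j) → vsum u′ + vsum w′ ≡ vsum u + vsum w →
    IsCylindric a b k (u , w) → IsCylindric a′ b′ k (u′ , w′)
  IsCylindric-resp u w u′ w′ u′≗u w′≗w size′ (pu , pw , w≤u , u≤w , size) =
    (λ j → ≤-resp (u′≗u (suc j)) (u′≗u j) (pu j)) , (λ j → ≤-resp (w′≗w (suc j)) (w′≗w j) (pw j)) ,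
    (λ j → ≤-resp (w′≗w j) (u′≗u j) (w≤u j)) , (λ j → ≤-resp (u′≗u (j + 4)) (w′≗w j) (u≤w j)) ,
    trans size′ size
    where
    ≤-resp : ∀ {x x′ y y′} → x′ ≡ x → y′ ≡ y → x ≤ y → x′ ≤ y′
    ≤-resp x′≡x y′≡y = subst₂ _≤_ (sym x′≡x) (sym y′≡y)

  part-∷ʳ-0 : ∀ {a} (u : Vec ℕ a) j → part (u ∷ʳ 0) j ≡ part u j
  part-∷ʳ-0 []      zero    = refl
  part-∷ʳ-0 []      (suc j) = refl
  part-∷ʳ-0 (x ∷ u) zero    = refl
  part-∷ʳ-0 (x ∷ u) (suc j) = part-∷ʳ-0 u j

  part-∷ʳ-last : ∀ {a} (u : Vec ℕ a) x → part (u ∷ʳ x) a ≡ x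
  part-∷ʳ-last []      x = refl
  part-∷ʳ-last (y ∷ u) x = part-∷ʳ-last u x

  part-≥ : ∀ {a} (u : Vec ℕ a) {j} → a ≤ j → part u j ≡ 0
  part-≥ []      _         = refl
  part-≥ (x ∷ u) (s≤s a≤j) = part-≥ u a≤j

  part-map-suc : ∀ {a} (u : Vec ℕ a) {j} → j < a → part (Vec.map suc u) j ≡ suc (part u j)
  part-map-suc (x ∷ u) {zero}  _         = refl
  part-map-suc (x ∷ u) {suc j} (s≤s j<a) = part-map-suc u j<a

  vsum-∷ʳ-0 : ∀ {a} (u : Vec ℕ a) → vsum (u ∷ʳ 0) ≡ vsum u
  vsum-∷ʳ-0 []      = refl
  vsum-∷ʳ-0 (x ∷ u) = cong (x +_) (vsum-∷ʳ-0 u)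

  vsum-map-suc : ∀ {a} (u : Vec ℕ a) → vsum (Vec.map suc u) ≡ vsum u + a
  vsum-map-suc []              = refl
  vsum-map-suc {suc a} (x ∷ u) rewrite vsum-map-suc u = trans (cong suc (sym (ℕ.+-assoc x (vsum u) a))) (sym (ℕ.+-suc _ a))

  ∷ʳ-init : ∀ {a} (u : Vec ℕ (suc a)) → u ≡ Vec.init u ∷ʳ part u a
  ∷ʳ-init {zero}  (x ∷ []) = refl
  ∷ʳ-init {suc a} (x ∷ u)  = cong (x ∷_) (∷ʳ-init u)

  map-suc-pred : ∀ {a} (u : Vec ℕ a) → (∀ j → j < a → 1 ≤ part u j) → Vec.map suc (Vec.map pred u) ≡ u
  map-suc-pred []            _   = refl
  map-suc-pred (suc x ∷ u)   pos = cong (suc x ∷_) (map-suc-pred u (λ j j<a → pos (suc j) (s≤s j<a)))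
  map-suc-pred (zero  ∷ u)   pos with pos 0 (s≤s z≤n)
  ... | ()

  map-pred-suc : ∀ {a} (u : Vec ℕ a) → Vec.map pred (Vec.map suc u) ≡ u
  map-pred-suc []      = refl
  map-pred-suc (x ∷ u) = cong (x ∷_) (map-pred-suc u)

  map-suc-mono : ∀ {m n} (v : Vec ℕ m) (v′ : Vec ℕ n) {i j} → (i < m → j < n) →
    part v i ≤ part v′ j → part (Vec.map suc v) i ≤ part (Vec.map suc v′) j
  map-suc-mono {m} v v′ {i} {j} in-range v≤v′ with ℕ.<-≤-connex i m
  ... | inj₂ m≤i rewrite part-≥ (Vec.map suc v) m≤i = z≤n
  ... | inj₁ i<m rewrite part-map-suc v i<m | part-map-suc v′ (in-range i<m) = s≤s v≤v′

  map-suc-mono⁻¹ : ∀ {m n} (v : Vec ℕ m) (v′ : Vec ℕ n) {i j} → (i < m → j < n) →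
    part (Vec.map suc v) i ≤ part (Vec.map suc v′) j → part v i ≤ part v′ j
  map-suc-mono⁻¹ {m} v v′ {i} {j} in-range v≤v′ with ℕ.<-≤-connex i m
  ... | inj₂ m≤i rewrite part-≥ v m≤i = z≤n
  ... | inj₁ i<m rewrite part-map-suc v i<m | part-map-suc v′ (in-range i<m) = ℕ.≤-pred v≤v′

  pad₁ : ∀ {a b} → Pair a b → Pair (suc a) b
  pad₁ (u , w) = u ∷ʳ 0 , w

  pad₂ : ∀ {a b} → Pair a b → Pair a (suc b)
  pad₂ (u , w) = u , w ∷ʳ 0

  -- Adds a first column to both diagrams (to all a + b slots); the size grows by a + b.
  raise : ∀ {a b} → Pair a b → Pair a b
  raise (u , w) = Vec.map suc u , Vec.map suc w

  lower : ∀ {a b} → Pair a b → Pair a b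
  lower (u , w) = Vec.map pred u , Vec.map pred w

  IsCylindric-pad₁ : ∀ {a b k} p → IsCylindric a b k p → IsCylindric (suc a) b k (pad₁ p)
  IsCylindric-pad₁ (u , w) = IsCylindric-resp u w (u ∷ʳ 0) w (part-∷ʳ-0 u) (λ _ → refl) (cong (_+ vsum w) (vsum-∷ʳ-0 u))

  IsCylindric-pad₁⁻¹ : ∀ {a b k} p → IsCylindric (suc a) b k (pad₁ p) → IsCylindric a b k p
  IsCylindric-pad₁⁻¹ (u , w) =
    IsCylindric-resp (u ∷ʳ 0) w u w (λ j → sym (part-∷ʳ-0 u j)) (λ _ → refl) (cong (_+ vsum w) (sym (vsum-∷ʳ-0 u)))

  IsCylindric-pad₂ : ∀ {a b k} p → IsCylindric a b k p → IsCylindric a (suc b) k (pad₂ p)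
  IsCylindric-pad₂ (u , w) = IsCylindric-resp u w u (w ∷ʳ 0) (λ _ → refl) (part-∷ʳ-0 w) (cong (vsum u +_) (vsum-∷ʳ-0 w))

  IsCylindric-pad₂⁻¹ : ∀ {a b k} p → IsCylindric a (suc b) k (pad₂ p) → IsCylindric a b k p
  IsCylindric-pad₂⁻¹ (u , w) =
    IsCylindric-resp u (w ∷ʳ 0) u w (λ _ → refl) (λ j → sym (part-∷ʳ-0 w j)) (cong (vsum u +_) (sym (vsum-∷ʳ-0 w)))

  vsum-raise : ∀ {a b} (u : Vec ℕ a) (w : Vec ℕ b) →
    vsum (Vec.map suc u) + vsum (Vec.map suc w) ≡ vsum u + vsum w + (a + b)
  vsum-raise {a} {b} u w rewrite vsum-map-suc u | vsum-map-suc w = +-interchange (vsum u) a (vsum w) b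
    where
    +-interchange : ∀ x y z t → x + y + (z + t) ≡ x + z + (y + t)
    +-interchange x y z t = trans (ℕ.+-assoc x y (z + t)) (trans (cong (x +_) (ℕ.+-comm y (z + t)))
      (trans (cong (x +_) (ℕ.+-assoc z t y)) (trans (cong (λ s → x + (z + s)) (ℕ.+-comm t y)) (sym (ℕ.+-assoc x z (y + t))))))

  module _ {a b : ℕ} (b≤a : b ≤ a) (a≤b+4 : a ≤ b + 4) where

    private
      w-in-range : ∀ {j} → j < b → j < a
      w-in-range j<b = ℕ.<-≤-trans j<b b≤a
      u-in-range : ∀ {j} → j + 4 < a → j < b
      u-in-range {j} j+4<a = ℕ.+-cancelʳ-< 4 j b (ℕ.<-≤-trans j+4<a a≤b+4)
      next-in-range : ∀ {n j} → suc j < n → j < n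
      next-in-range {j = j} = ℕ.<-trans (ℕ.n<1+n j)

    IsCylindric-raise : ∀ {k} p → IsCylindric a b k p → IsCylindric a b (k + (a + b)) (raise p)
    IsCylindric-raise (u , w) (pu , pw , w≤u , u≤w , size) =
      (λ j → map-suc-mono u u next-in-range (pu j)) , (λ j → map-suc-mono w w next-in-range (pw j)) ,
      (λ j → map-suc-mono w u w-in-range (w≤u j)) , (λ j → map-suc-mono u w u-in-range (u≤w j)) ,
      trans (vsum-raise u w) (cong (_+ (a + b)) size)

    IsCylindric-raise⁻¹ : ∀ {k} p → IsCylindric a b k (raise p) → a + b ≤ k × IsCylindric a b (k ∸ (a + b)) p
    IsCylindric-raise⁻¹ {k} (u , w) (pu , pw , w≤u , u≤w , size) =
      subst (a + b ≤_) size′ (ℕ.m≤n+m (a + b) (vsum u + vsum w)) ,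
      (λ j → map-suc-mono⁻¹ u u next-in-range (pu j)) , (λ j → map-suc-mono⁻¹ w w next-in-range (pw j)) ,
      (λ j → map-suc-mono⁻¹ w u w-in-range (w≤u j)) , (λ j → map-suc-mono⁻¹ u w u-in-range (u≤w j)) ,
      trans (sym (ℕ.m+n∸n≡m _ (a + b))) (cong (_∸ (a + b)) size′)
      where
      size′ : vsum u + vsum w + (a + b) ≡ k
      size′ = trans (sym (vsum-raise u w)) size

  part-antitone : ∀ {n} (v : Vec ℕ n) → IsPartition v → ∀ {i j} → i ≤ j → part v j ≤ part v i
  part-antitone v pv {i} {j} i≤j with ℕ.m≤n⇒m<n∨m≡n i≤j
  ... | inj₂ refl = ℕ.≤-refl
  part-antitone v pv {i} {suc j} _ | inj₁ (s≤s i≤j) = ℕ.≤-trans (pv j) (part-antitone v pv i≤j)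

  last-part-positive : ∀ {n} (v : Vec ℕ n) → IsPartition v → 1 ≤ part v (pred n) → ∀ j → j < n → 1 ≤ part v j
  last-part-positive {suc n} v pv last≥1 j (s≤s j≤n) = ℕ.≤-trans last≥1 (part-antitone v pv j≤n)

  Type₁ : ∀ {a b} → Pair a b → Set
  Type₁ {a} {b} (u , w) = b < a × (b ≡ 0 ⊎ part u (pred a) ≤ part w (pred b))

  type₁? : ∀ {a b} (p : Pair a b) → Dec (Type₁ p)
  type₁? {a} {b} (u , w) = (b ℕ.<? a) ×-dec ((b ℕ.≟ 0) ⊎-dec (part u (pred a) ℕ.≤? part w (pred b)))

  Type₁-pad₁ : ∀ {a b} → b ≤ a → (p : Pair a b) → Type₁ (pad₁ p)
  Type₁-pad₁ {a} b≤a (u , w) = s≤s b≤a , inj₂ (subst (_≤ _) (sym (part-∷ʳ-last u 0)) z≤n)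

  Type₁-raise : ∀ {a b} (p : Pair a b) → Type₁ p → Type₁ (raise p)
  Type₁-raise {suc a} {zero}  (u , w) (b<a , _)                = b<a , inj₁ refl
  Type₁-raise {suc a} {suc b} (u , w) (b<a , inj₂ last≤last)
    rewrite part-map-suc u (ℕ.n<1+n a) | part-map-suc w (ℕ.n<1+n b) = b<a , inj₂ (s≤s last≤last)

  Type₁-raise⁻¹ : ∀ {a b} (p : Pair a b) → Type₁ (raise p) → Type₁ p
  Type₁-raise⁻¹ {suc a} {zero}  (u , w) (b<a , _)                = b<a , inj₁ refl
  Type₁-raise⁻¹ {suc a} {suc b} (u , w) (b<a , inj₂ last≤last)
    rewrite part-map-suc u (ℕ.n<1+n a) | part-map-suc w (ℕ.n<1+n b) = b<a , inj₂ (ℕ.≤-pred last≤last)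

  ¬Type₁-square : ∀ {b} (p : Pair b b) → ¬ Type₁ p
  ¬Type₁-square _ (b<b , _) = ℕ.<-irrefl refl b<b

  ¬Type₁-pad₂ : ∀ {a b} (p : Pair a b) → ¬ Type₁ p → ¬ Type₁ (pad₂ p)
  ¬Type₁-pad₂ {a} {b} (u , w) ¬t (s≤s b<a , inj₂ last≤0) rewrite part-∷ʳ-last w 0 =
    ¬t (ℕ.<-trans (ℕ.n<1+n b) (s≤s b<a) , inj₂ (subst (_≤ part w (pred b)) (sym (ℕ.n≤0⇒n≡0 last≤0)) z≤n))

  ¬Type₁-pad₂-raise : ∀ {a b} (p : Pair (suc a) b) → ¬ Type₁ (pad₂ (raise p))
  ¬Type₁-pad₂-raise {a} (u , w) (_ , inj₂ last≤0)
    rewrite part-∷ʳ-last (Vec.map suc w) 0 | part-map-suc u (ℕ.n<1+n a) = ℕ.n≮0 last≤0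

  unpad₂ : ∀ {a b} → Pair a (suc b) → Pair a b
  unpad₂ (u , w) = u , Vec.init w

  unpad₂-pad₂ : ∀ {a b} (p : Pair a b) → unpad₂ (pad₂ p) ≡ p
  unpad₂-pad₂ (u , w) = cong (u ,_) (VecP.init-∷ʳ 0 w)

  lower-raise : ∀ {a b} (p : Pair a b) → lower (raise p) ≡ p
  lower-raise (u , w) = cong₂ _,_ (map-pred-suc u) (map-pred-suc w)

  pad₁-injective : ∀ {a b} {p q : Pair a b} → pad₁ p ≡ pad₁ q → p ≡ q
  pad₁-injective {p = u , w} {u′ , w′} eq = cong₂ _,_ (VecP.∷ʳ-injectiveˡ u u′ (cong proj₁ eq)) (cong proj₂ eq)

  pad₂-injective : ∀ {a b} {p q : Pair a b} → pad₂ p ≡ pad₂ q → p ≡ q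
  pad₂-injective {p = p} {q} eq = trans (sym (unpad₂-pad₂ p)) (trans (cong unpad₂ eq) (unpad₂-pad₂ q))

  raise-injective : ∀ {a b} {p q : Pair a b} → raise p ≡ raise q → p ≡ q
  raise-injective {p = p} {q} eq = trans (sym (lower-raise p)) (trans (cong lower eq) (lower-raise q))

  unpad₁ : ∀ {a b} → Pair (suc a) b → Pair a b
  unpad₁ (u , w) = Vec.init u , w

  pad₁-unpad₁ : ∀ {a b} (p : Pair (suc a) b) → part (proj₁ p) a ≡ 0 → pad₁ (unpad₁ p) ≡ p
  pad₁-unpad₁ {a} (u , w) last≡0 = cong (_, w) (sym (trans (∷ʳ-init u) (cong (Vec.init u ∷ʳ_) last≡0)))

  pad₂-unpad₂ : ∀ {a b} (p : Pair a (suc b)) → part (proj₂ p) b ≡ 0 → pad₂ (unpad₂ p) ≡ p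
  pad₂-unpad₂ {b = b} (u , w) last≡0 = cong (u ,_) (sym (trans (∷ʳ-init w) (cong (Vec.init w ∷ʳ_) last≡0)))

  AllPositive : ∀ {a b} → Pair a b → Set
  AllPositive {a} {b} (u , w) = (∀ j → j < a → 1 ≤ part u j) × (∀ j → j < b → 1 ≤ part w j)

  raise-lower : ∀ {a b} (p : Pair a b) → AllPositive p → raise (lower p) ≡ p
  raise-lower (u , w) (u>0 , w>0) = cong₂ _,_ (map-suc-pred u u>0) (map-suc-pred w w>0)

module Enumeration where

  open import Defs
  open PowerSeries using (shift; shift-≥; shift-<; _⊕_)
  open CylindricPairs
  open import Data.Nat as ℕ using (ℕ; zero; suc; z≤n; s≤s; _≤_; _<_; _+_; _∸_; _≤?_; _≟_)
  import Data.Nat.Properties as ℕ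
  open import Data.Integer as ℤ using (+_)
  import Data.Integer.Properties as ℤ
  open import Data.List using (List; []; _∷_; _++_; map; length)
  import Data.List.Properties as List
  open import Data.Vec using ([])
  open import Data.Product using (_×_; _,_)
  open import Function using (_∘_)
  open import Relation.Nullary using (Dec; yes; no; ¬_; contradiction)
  open import Relation.Binary.PropositionalEquality

  when : ∀ {p} {P : Set p} {A : Set} → Dec P → List A → List A
  when (yes _) xs = xs
  when (no _)  _  = []

  when-cong : ∀ {p} {P : Set p} {A : Set} (d : Dec P) {xs ys : List A} → (P → xs ≡ ys) → when d xs ≡ when d ys
  when-cong (yes p) xs≡ys = xs≡ys p
  when-cong (no _)  _     = refl

  data Shape₂ (a b : ℕ) : Set where
    square : a ≡ suc b → Shape₂ a b
    inner  : suc (suc b) ≤ a → a ≤ b + 4 → Shape₂ a b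
    outer  : a ≢ suc b → ¬ (suc (suc b) ≤ a × a ≤ b + 4) → Shape₂ a b

  shape₂ : ∀ a b → Shape₂ a b
  shape₂ a b with a ≟ suc b | suc (suc b) ≤? a | a ≤? b + 4
  ... | yes a≡b+1 | _     | _     = square a≡b+1
  ... | no a≢b+1  | yes l | yes u = inner l u
  ... | no a≢b+1  | no ¬l | _     = outer a≢b+1 (λ (l , _) → ¬l l)
  ... | no a≢b+1  | yes _ | no ¬u = outer a≢b+1 (λ (_ , u) → ¬u u)

  -- E f a b k lists the cylindric pairs of size k, those of type 1 (E₁) before the others (E₂);
  -- any fuel f > a + b + k suffices.  A pair whose first (E₁) or second (E₂) partition ends in a
  -- zero slot is padded from a smaller shape, otherwise all entries are positive and it is raised
  -- from a smaller size; in the inner shapes a padded pair may also stem from a raised type-1 pair.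
  mutual
    E : ℕ → (a b k : ℕ) → List (Pair a b)
    E f a b k = E₁ f a b k ++ E₂ f a b k

    E₁ : ℕ → (a b k : ℕ) → List (Pair a b)
    E₁ zero    _       _ _ = []
    E₁ (suc f) zero    b k = []
    E₁ (suc f) (suc a) b k = when (b ≤? a)
      (map pad₁ (E f a b k) ++ when (suc a + b ≤? k) (map raise (E₁ f (suc a) b (k ∸ (suc a + b)))))

    E₂ : ℕ → (a b k : ℕ) → List (Pair a b)
    E₂ zero    _       _       _ = []
    E₂ (suc f) a       (suc b) k = E₂-step f a b k (shape₂ a b)
    E₂ (suc f) zero    zero    k = when (k ≟ 0) (([] , []) ∷ [])
    E₂ (suc f) (suc a) zero    k = []

    E₂-step : ℕ → (a b k : ℕ) → Shape₂ a b → List (Pair a (suc b))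
    E₂-step f a b k (square _)  =
      map pad₂ (E f a b k) ++ when (a + suc b ≤? k) (map raise (E₂ f a (suc b) (k ∸ (a + suc b))))
    E₂-step f a b k (inner _ _) =
      map pad₂ (E₂ f a b k) ++ (map pad₂ (when (a + b ≤? k) (map raise (E₁ f a b (k ∸ (a + b)))))
                            ++ when (a + suc b ≤? k) (map raise (E₂ f a (suc b) (k ∸ (a + suc b)))))
    E₂-step f a b k (outer _ _) = []

  below-fuel : ∀ n {k f} → 0 < n → n + k ≤ f → k < f
  below-fuel n {k} 0<n n+k≤f = ℕ.<-≤-trans (ℕ.m<n+m k 0<n) n+k≤f

  fuel-raise : ∀ {N k f} → N ≤ k → k < f → N + (k ∸ N) < f
  fuel-raise N≤k k<f rewrite ℕ.m+[n∸m]≡n N≤k = k<f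

  fuel-pad₂ : ∀ a b {k f} → a + suc b + k ≤ f → a + b + k < f
  fuel-pad₂ a b {k} {f} = subst (_≤ f) (cong (_+ k) (ℕ.+-suc a b))

  mutual
    E-fuel : ∀ {f f′} a b k → a + b + k < f → a + b + k < f′ → E f a b k ≡ E f′ a b k
    E-fuel a b k bound bound′ = cong₂ _++_ (E₁-fuel a b k bound bound′) (E₂-fuel a b k bound bound′)

    E₁-fuel : ∀ {f f′} a b k → a + b + k < f → a + b + k < f′ → E₁ f a b k ≡ E₁ f′ a b k
    E₁-fuel {suc f} {suc f′} zero    b k _ _ = refl
    E₁-fuel {suc f} {suc f′} (suc a) b k (s≤s bound) (s≤s bound′) =
      when-cong (b ≤? a) (λ _ → cong₂ _++_ (cong (map pad₁) (E-fuel a b k bound bound′))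
        (when-cong (suc a + b ≤? k) (λ N≤k → cong (map raise) (E₁-fuel (suc a) b (k ∸ (suc a + b))
          (fuel-raise N≤k (below-fuel (suc a + b) (s≤s z≤n) bound))
          (fuel-raise N≤k (below-fuel (suc a + b) (s≤s z≤n) bound′))))))

    E₂-fuel : ∀ {f f′} a b k → a + b + k < f → a + b + k < f′ → E₂ f a b k ≡ E₂ f′ a b k
    E₂-fuel {suc f} {suc f′} a       (suc b) k (s≤s bound) (s≤s bound′) = E₂-step-fuel a b k (shape₂ a b) bound bound′
    E₂-fuel {suc f} {suc f′} zero    zero    k _ _ = refl
    E₂-fuel {suc f} {suc f′} (suc a) zero    k _ _ = refl

    E₂-step-fuel : ∀ {f f′} a b k s → a + suc b + k ≤ f → a + suc b + k ≤ f′ →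
      E₂-step f a b k s ≡ E₂-step f′ a b k s
    E₂-step-fuel a b k (square _) bound bound′ =
      cong₂ _++_ (cong (map pad₂) (E-fuel a b k (fuel-pad₂ a b bound) (fuel-pad₂ a b bound′)))
        (raised-fuel a b k bound bound′)
    E₂-step-fuel a b k (inner b+2≤a _) bound bound′ =
      cong₂ _++_ (cong (map pad₂) (E₂-fuel a b k (fuel-pad₂ a b bound) (fuel-pad₂ a b bound′)))
        (cong₂ _++_ (cong (map pad₂) (when-cong (a + b ≤? k) (λ N≤k → cong (map raise) (E₁-fuel a b (k ∸ (a + b))
                      (fuel-raise N≤k (below-fuel (a + suc b) 0<a+b+1 bound))
                      (fuel-raise N≤k (below-fuel (a + suc b) 0<a+b+1 bound′))))))
                    (raised-fuel a b k bound bound′))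
      where
      0<a+b+1 : 0 < a + suc b
      0<a+b+1 = ℕ.<-≤-trans (s≤s z≤n) (ℕ.m≤n+m (suc b) a)
    E₂-step-fuel a b k (outer _ _) _ _ = refl

    raised-fuel : ∀ {f f′} a b k → a + suc b + k ≤ f → a + suc b + k ≤ f′ →
      when (a + suc b ≤? k) (map raise (E₂ f a (suc b) (k ∸ (a + suc b))))
        ≡ when (a + suc b ≤? k) (map raise (E₂ f′ a (suc b) (k ∸ (a + suc b))))
    raised-fuel a b k bound bound′ = when-cong (a + suc b ≤? k) (λ N≤k → cong (map raise)
      (E₂-fuel a (suc b) (k ∸ (a + suc b)) (fuel-raise N≤k (below-fuel (a + suc b) 0<a+b+1 bound))
                                           (fuel-raise N≤k (below-fuel (a + suc b) 0<a+b+1 bound′))))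
      where
      0<a+b+1 : 0 < a + suc b
      0<a+b+1 = ℕ.<-≤-trans (s≤s z≤n) (ℕ.m≤n+m (suc b) a)

  E₁-unfold : ∀ f a b k → b ≤ a → E₁ (suc f) (suc a) b k ≡
    map pad₁ (E f a b k) ++ when (suc a + b ≤? k) (map raise (E₁ f (suc a) b (k ∸ (suc a + b))))
  E₁-unfold f a b k b≤a with b ≤? a
  ... | yes _   = refl
  ... | no b≰a = contradiction b≤a b≰a

  E₁-square : ∀ f b k → E₁ f (suc b) (suc b) k ≡ []
  E₁-square zero    b k = refl
  E₁-square (suc f) b k with suc b ≤? b
  ... | yes b+1≤b = contradiction b+1≤b (ℕ.<-irrefl refl)
  ... | no _      = refl

  E₂-square : ∀ f b k → E₂ (suc f) (suc b) (suc b) k ≡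
    map pad₂ (E f (suc b) b k) ++ when (suc b + suc b ≤? k) (map raise (E₂ f (suc b) (suc b) (k ∸ (suc b + suc b))))
  E₂-square f b k with shape₂ (suc b) b
  ... | square _         = refl
  ... | inner b+2≤b+1 _  = contradiction b+2≤b+1 (ℕ.<-irrefl refl)
  ... | outer b+1≢b+1 _  = contradiction refl b+1≢b+1

  E₂-inner : ∀ f a b k → suc (suc b) ≤ a → a ≤ b + 4 → E₂ (suc f) a (suc b) k ≡
    map pad₂ (E₂ f a b k) ++ (map pad₂ (when (a + b ≤? k) (map raise (E₁ f a b (k ∸ (a + b)))))
                          ++ when (a + suc b ≤? k) (map raise (E₂ f a (suc b) (k ∸ (a + suc b)))))
  E₂-inner f a b k b+2≤a a≤b+4 with shape₂ a b
  ... | square a≡b+1 = contradiction (subst (suc (suc b) ≤_) a≡b+1 b+2≤a) (ℕ.<-irrefl refl)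
  ... | inner _ _    = refl
  ... | outer _ ¬in  = contradiction (b+2≤a , a≤b+4) ¬in

  E₂-top : ∀ f b k → E₂ (suc f) (4 + suc b) (suc b) k ≡ []
  E₂-top f b k with shape₂ (4 + suc b) b
  ... | square b+5≡b+1 = contradiction (ℕ.suc-injective b+5≡b+1) (ℕ.m+1+n≢n 3 {b} ∘ trans (sym (ℕ.+-suc 3 b)))
  ... | inner _ b+5≤b+4 = contradiction (subst (4 + suc b ≤_) (ℕ.+-comm b 4) b+5≤b+4) (ℕ.<-irrefl refl)
  ... | outer _ _       = refl

  enumerate enumerate₁ enumerate₂ : (a b k : ℕ) → List (Pair a b)
  enumerate  a b k = E  (suc (a + b + k)) a b k
  enumerate₁ a b k = E₁ (suc (a + b + k)) a b k
  enumerate₂ a b k = E₂ (suc (a + b + k)) a b k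

  count count₁ count₂ : ℕ → ℕ → Series
  count  a b k = + length (enumerate  a b k)
  count₁ a b k = + length (enumerate₁ a b k)
  count₂ a b k = + length (enumerate₂ a b k)

  private
    length-++ℤ : ∀ {A : Set} (xs ys : List A) → + length (xs ++ ys) ≡ + length xs ℤ.+ + length ys
    length-++ℤ xs ys = trans (cong +_ (List.length-++ xs)) (ℤ.pos-+ (length xs) (length ys))

    length-map-when : ∀ {A B : Set} (g : A → B) N k (xs : List A) (F : Series) →
      (N ≤ k → + length xs ≡ F (k ∸ N)) → + length (when (N ≤? k) (map g xs)) ≡ shift N F k
    length-map-when g N k xs F length≡ with N ≤? k
    ... | yes N≤k = trans (cong +_ (List.length-map g xs)) (trans (length≡ N≤k) (sym (shift-≥ N F N≤k)))
    ... | no N≰k  = sym (shift-< N F (ℕ.≰⇒> N≰k))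

    count-fuel : ∀ {f} a b k → a + b + k < f → + length (E f a b k) ≡ count a b k
    count-fuel a b k bound = cong (+_ ∘ length) (E-fuel a b k bound ℕ.≤-refl)

    count₁-fuel : ∀ {f} a b k → a + b + k < f → + length (E₁ f a b k) ≡ count₁ a b k
    count₁-fuel a b k bound = cong (+_ ∘ length) (E₁-fuel a b k bound ℕ.≤-refl)

    count₂-fuel : ∀ {f} a b k → a + b + k < f → + length (E₂ f a b k) ≡ count₂ a b k
    count₂-fuel a b k bound = cong (+_ ∘ length) (E₂-fuel a b k bound ℕ.≤-refl)

  count-split : ∀ a b → count a b ≗ count₁ a b ⊕ count₂ a b
  count-split a b k = length-++ℤ (enumerate₁ a b k) (enumerate₂ a b k)

  count≗count₁ : ∀ a b → count₂ a b ≗ zeroS → count a b ≗ count₁ a b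
  count≗count₁ a b count₂≗0 k =
    trans (count-split a b k) (trans (cong (ℤ._+_ (count₁ a b k)) (count₂≗0 k)) (ℤ.+-identityʳ _))

  count≗count₂ : ∀ a b → count₁ a b ≗ zeroS → count a b ≗ count₂ a b
  count≗count₂ a b count₁≗0 k =
    trans (count-split a b k) (trans (cong (ℤ._+ count₂ a b k) (count₁≗0 k)) (ℤ.+-identityˡ _))

  count₁-origin : count₁ 0 0 ≗ zeroS
  count₁-origin k = refl

  count₂-origin : count₂ 0 0 ≗ oneS
  count₂-origin zero    = refl
  count₂-origin (suc k) = refl

  count₂-axis : ∀ a → count₂ (suc a) 0 ≗ zeroS
  count₂-axis a k = refl

  count₁-square : ∀ b → count₁ (suc b) (suc b) ≗ zeroS
  count₁-square b k = cong (+_ ∘ length) (E₁-square (suc (suc b + suc b + k)) b k)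

  count₂-top : ∀ b → count₂ (4 + suc b) (suc b) ≗ zeroS
  count₂-top b k = cong (+_ ∘ length) (E₂-top (4 + suc b + suc b + k) b k)

  count₁-rec : ∀ {a b} → b ≤ a → count₁ (suc a) b ≗ count a b ⊕ shift (suc a + b) (count₁ (suc a) b)
  count₁-rec {a} {b} b≤a k = begin
    count₁ (suc a) b k
      ≡⟨ cong (+_ ∘ length) (E₁-unfold f a b k b≤a) ⟩
    + length (map pad₁ (E f a b k) ++ when (N ≤? k) (map raise (E₁ f (suc a) b (k ∸ N))))
      ≡⟨ length-++ℤ (map pad₁ (E f a b k)) _ ⟩
    + length (map pad₁ (E f a b k)) ℤ.+ + length (when (N ≤? k) (map raise (E₁ f (suc a) b (k ∸ N))))
      ≡⟨ cong₂ ℤ._+_ (cong +_ (List.length-map pad₁ (E f a b k)))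
           (length-map-when raise N k _ _ (λ N≤k → count₁-fuel (suc a) b (k ∸ N) (fuel-raise N≤k k<f))) ⟩
    count a b k ℤ.+ shift N (count₁ (suc a) b) k ∎
    where
    open ≡-Reasoning
    f = suc a + b + k
    N = suc a + b
    k<f : k < f
    k<f = below-fuel N (s≤s z≤n) ℕ.≤-refl

  count₂-square-rec : ∀ b → count₂ (suc b) (suc b) ≗ count (suc b) b ⊕ shift (suc b + suc b) (count₂ (suc b) (suc b))
  count₂-square-rec b k = begin
    count₂ (suc b) (suc b) k
      ≡⟨ cong (+_ ∘ length) (E₂-square f b k) ⟩
    + length (map pad₂ (E f (suc b) b k) ++ when (N ≤? k) (map raise (E₂ f (suc b) (suc b) (k ∸ N))))
      ≡⟨ length-++ℤ (map pad₂ (E f (suc b) b k)) _ ⟩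
    + length (map pad₂ (E f (suc b) b k)) ℤ.+ + length (when (N ≤? k) (map raise (E₂ f (suc b) (suc b) (k ∸ N))))
      ≡⟨ cong₂ ℤ._+_ (trans (cong +_ (List.length-map pad₂ (E f (suc b) b k)))
                            (count-fuel (suc b) b k (fuel-pad₂ (suc b) b ℕ.≤-refl)))
           (length-map-when raise N k _ _ (λ N≤k → count₂-fuel (suc b) (suc b) (k ∸ N) (fuel-raise N≤k k<f))) ⟩
    count (suc b) b k ℤ.+ shift N (count₂ (suc b) (suc b)) k ∎
    where
    open ≡-Reasoning
    f = suc b + suc b + k
    N = suc b + suc b
    k<f : k < f
    k<f = below-fuel N (s≤s z≤n) ℕ.≤-refl

  count₂-inner-rec : ∀ {a b} → suc (suc b) ≤ a → a ≤ b + 4 →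
    count₂ a (suc b) ≗ count₂ a b ⊕ shift (a + b) (count₁ a b) ⊕ shift (a + suc b) (count₂ a (suc b))
  count₂-inner-rec {a} {b} b+2≤a a≤b+4 k = begin
    count₂ a (suc b) k
      ≡⟨ cong (+_ ∘ length) (E₂-inner f a b k b+2≤a a≤b+4) ⟩
    + length (map pad₂ (E₂ f a b k) ++ (padded ++ raised))
      ≡⟨ length-++ℤ (map pad₂ (E₂ f a b k)) (padded ++ raised) ⟩
    + length (map pad₂ (E₂ f a b k)) ℤ.+ + length (padded ++ raised)
      ≡⟨ cong (ℤ._+_ (+ length (map pad₂ (E₂ f a b k)))) (length-++ℤ padded raised) ⟩
    + length (map pad₂ (E₂ f a b k)) ℤ.+ (+ length padded ℤ.+ + length raised)
      ≡⟨ sym (ℤ.+-assoc (+ length (map pad₂ (E₂ f a b k))) (+ length padded) (+ length raised)) ⟩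
    + length (map pad₂ (E₂ f a b k)) ℤ.+ + length padded ℤ.+ + length raised
      ≡⟨ cong₂ ℤ._+_ (cong₂ ℤ._+_
           (trans (cong +_ (List.length-map pad₂ (E₂ f a b k))) (count₂-fuel a b k (fuel-pad₂ a b ℕ.≤-refl)))
           (trans (cong +_ (List.length-map pad₂ (when (a + b ≤? k) (map raise (E₁ f a b (k ∸ (a + b)))))))
             (length-map-when raise (a + b) k _ _ (λ N≤k → count₁-fuel a b (k ∸ (a + b)) (fuel-raise N≤k k<f)))))
           (length-map-when raise (a + suc b) k _ _ (λ N≤k → count₂-fuel a (suc b) (k ∸ (a + suc b)) (fuel-raise N≤k k<f))) ⟩
    count₂ a b k ℤ.+ shift (a + b) (count₁ a b) k ℤ.+ shift (a + suc b) (count₂ a (suc b)) k ∎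
    where
    open ≡-Reasoning
    f = a + suc b + k
    padded raised : List (Pair a (suc b))
    padded = map pad₂ (when (a + b ≤? k) (map raise (E₁ f a b (k ∸ (a + b)))))
    raised = when (a + suc b ≤? k) (map raise (E₂ f a (suc b) (k ∸ (a + suc b))))
    k<f : k < f
    k<f = below-fuel (a + suc b) (ℕ.<-≤-trans (s≤s z≤n) (ℕ.m≤n+m (suc b) a)) ℕ.≤-refl

module EnumerationCorrect where

  open import Defs
  open CylindricPairs
  open Enumeration
  open import Data.Nat as ℕ using (ℕ; zero; suc; z≤n; s≤s; _≤_; _<_; _+_; _∸_; _≤?_; _≟_)
  import Data.Nat.Properties as ℕ
  open import Data.List using (List; []; _∷_; map)
  open import Data.List.Membership.Propositional using (_∈_)
  open import Data.List.Membership.Propositional.Properties using (∈-map⁺; ∈-++⁺ˡ; ∈-++⁺ʳ)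
  open import Data.List.Relation.Unary.Any using (here)
  open import Data.List.Relation.Unary.AllPairs using ([]; _∷_)
  open import Data.List.Relation.Unary.All as All using (All; []; _∷_)
  import Data.List.Relation.Unary.All.Properties as Allₚ
  open import Data.List.Relation.Unary.Unique.Propositional using (Unique)
  import Data.List.Relation.Unary.Unique.Propositional.Properties as Uniqueₚ
  open import Data.List.Relation.Binary.Disjoint.Propositional using (Disjoint)
  open import Data.Vec as Vec using (Vec; [])
  open import Data.Product using (_×_; _,_; proj₁; proj₂)
  open import Data.Sum using (_⊎_; inj₁; inj₂)
  open import Function using (_∘_; _⇔_; mk⇔)
  open import Relation.Nullary using (Dec; yes; no; ¬_; contradiction)
  open import Relation.Binary.PropositionalEquality

  b+1≤b+4 : ∀ b → suc b ≤ b + 4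
  b+1≤b+4 b = subst (suc b ≤_) (ℕ.+-comm 4 b) (s≤s (ℕ.m≤n+m b 3))

  ∈-when⁺ : ∀ {p} {P : Set p} {A : Set} (d : Dec P) {xs : List A} {x} → P → x ∈ xs → x ∈ when d xs
  ∈-when⁺ (yes _) _ x∈xs = x∈xs
  ∈-when⁺ (no ¬p) p _    = contradiction p ¬p

  All-when : ∀ {p q} {P : Set p} {A : Set} {Q : A → Set q} (d : Dec P) {xs : List A} → (P → All Q xs) → All Q (when d xs)
  All-when (yes p) all = all p
  All-when (no _)  _   = []

  mutual
    E₁-type₁ : ∀ f a b k → All Type₁ (E₁ f a b k)
    E₁-type₁ zero    _       _ _ = []
    E₁-type₁ (suc f) zero    b k = []
    E₁-type₁ (suc f) (suc a) b k = All-when (b ≤? a) (λ b≤a →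
      Allₚ.++⁺ (Allₚ.map⁺ (All.universal (Type₁-pad₁ b≤a) (E f a b k)))
               (All-when (suc a + b ≤? k) (λ _ → Allₚ.map⁺ (All.map (λ {y} → Type₁-raise y) (E₁-type₁ f (suc a) b _)))))

    E₂-¬type₁ : ∀ f a b k → All (¬_ ∘ Type₁) (E₂ f a b k)
    E₂-¬type₁ zero    _       _       _ = []
    E₂-¬type₁ (suc f) a       (suc b) k = E₂-step-¬type₁ f a b k (shape₂ a b)
    E₂-¬type₁ (suc f) zero    zero    k = All-when (k ≟ 0) (λ _ → (λ ()) ∷ [])
    E₂-¬type₁ (suc f) (suc a) zero    k = []

    E₂-step-¬type₁ : ∀ f a b k s → All (¬_ ∘ Type₁) (E₂-step f a b k s)
    E₂-step-¬type₁ f a b k (square refl) = All.universal ¬Type₁-square _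
    E₂-step-¬type₁ f (suc a) b k (inner (s≤s _) _) =
      Allₚ.++⁺ (Allₚ.map⁺ (All.map (λ {x} → ¬Type₁-pad₂ x) (E₂-¬type₁ f (suc a) b k)))
      (Allₚ.++⁺ (Allₚ.map⁺ (All-when (suc a + b ≤? k) (λ _ → Allₚ.map⁺ (All.universal ¬Type₁-pad₂-raise _))))
                (All-when (suc a + suc b ≤? k) (λ _ → Allₚ.map⁺
                  (All.map (λ {y} ¬t → ¬t ∘ Type₁-raise⁻¹ y) (E₂-¬type₁ f (suc a) (suc b) _)))))
    E₂-step-¬type₁ f a b k (outer _ _) = []

  private
    disjoint-by : ∀ {A : Set} (P : A → Set) {xs ys : List A} → All P xs → All (¬_ ∘ P) ys → Disjoint xs ys
    disjoint-by P xs⊆P ys⊆¬P (v∈xs , v∈ys) = All.lookup ys⊆¬P v∈ys (All.lookup xs⊆P v∈xs)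

    when-unique : ∀ {p} {P : Set p} {A : Set} (d : Dec P) {xs : List A} → Unique xs → Unique (when d xs)
    when-unique (yes _) xs! = xs!
    when-unique (no _)  _   = []

    FirstEndsInZero : ∀ {a b} → Pair (suc a) b → Set
    FirstEndsInZero {a} (u , w) = part u a ≡ 0

    SecondEndsInZero : ∀ {a b} → Pair a (suc b) → Set
    SecondEndsInZero {b = b} (u , w) = part w b ≡ 0

    pad₁-ends-in-zero : ∀ {a b} (x : Pair a b) → FirstEndsInZero (pad₁ x)
    pad₁-ends-in-zero (u , w) = part-∷ʳ-last u 0

    pad₂-ends-in-zero : ∀ {a b} (x : Pair a b) → SecondEndsInZero (pad₂ x)
    pad₂-ends-in-zero (u , w) = part-∷ʳ-last w 0

    raise-ends-positive₁ : ∀ {a b} (y : Pair (suc a) b) → ¬ FirstEndsInZero (raise y)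
    raise-ends-positive₁ {a} (u , w) last≡0 = ℕ.1+n≢0 (trans (sym (part-map-suc u (ℕ.n<1+n a))) last≡0)

    raise-ends-positive₂ : ∀ {a b} (y : Pair a (suc b)) → ¬ SecondEndsInZero (raise y)
    raise-ends-positive₂ {b = b} (u , w) last≡0 = ℕ.1+n≢0 (trans (sym (part-map-suc w (ℕ.n<1+n b))) last≡0)

    padded-ends-in-zero : ∀ {a b} (xs : List (Pair a b)) → All SecondEndsInZero (map pad₂ xs)
    padded-ends-in-zero xs = Allₚ.map⁺ (All.universal pad₂-ends-in-zero xs)

    raised-ends-positive : ∀ f a b k →
      All (¬_ ∘ SecondEndsInZero) (when (a + suc b ≤? k) (map raise (E₂ f a (suc b) (k ∸ (a + suc b)))))
    raised-ends-positive f a b k = All-when (a + suc b ≤? k) (λ _ → Allₚ.map⁺ (All.universal raise-ends-positive₂ _))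

  mutual
    E-unique : ∀ f a b k → Unique (E f a b k)
    E-unique f a b k = Uniqueₚ.++⁺ (E₁-unique f a b k) (E₂-unique f a b k)
      (disjoint-by Type₁ (E₁-type₁ f a b k) (E₂-¬type₁ f a b k))

    E₁-unique : ∀ f a b k → Unique (E₁ f a b k)
    E₁-unique zero    _       _ _ = []
    E₁-unique (suc f) zero    b k = []
    E₁-unique (suc f) (suc a) b k with b ≤? a
    ... | no _  = []
    ... | yes _ = Uniqueₚ.++⁺ (Uniqueₚ.map⁺ pad₁-injective (E-unique f a b k))
      (when-unique (suc a + b ≤? k) (Uniqueₚ.map⁺ raise-injective (E₁-unique f (suc a) b _)))
      (disjoint-by FirstEndsInZero (Allₚ.map⁺ (All.universal pad₁-ends-in-zero _))
        (All-when (suc a + b ≤? k) (λ _ → Allₚ.map⁺ (All.universal raise-ends-positive₁ _))))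

    E₂-unique : ∀ f a b k → Unique (E₂ f a b k)
    E₂-unique zero    _       _       _ = []
    E₂-unique (suc f) a       (suc b) k = E₂-step-unique f a b k (shape₂ a b)
    E₂-unique (suc f) zero    zero    k = when-unique (k ≟ 0) (All.[] ∷ [])
    E₂-unique (suc f) (suc a) zero    k = []

    E₂-step-unique : ∀ f a b k s → Unique (E₂-step f a b k s)
    E₂-step-unique f a b k (square _) =
      Uniqueₚ.++⁺ (Uniqueₚ.map⁺ pad₂-injective (E-unique f a b k)) (raised-unique f a b k)
        (disjoint-by SecondEndsInZero (padded-ends-in-zero _) (raised-ends-positive f a b k))
    E₂-step-unique f a b k (inner _ _) =
      Uniqueₚ.++⁺ (Uniqueₚ.map⁺ pad₂-injective (E₂-unique f a b k))
        (Uniqueₚ.++⁺ (Uniqueₚ.map⁺ pad₂-injective lifted-unique) (raised-unique f a b k)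
          (disjoint-by SecondEndsInZero (padded-ends-in-zero _) (raised-ends-positive f a b k)))
        (disjoint-by (λ p → SecondEndsInZero p × ¬ Type₁ (unpad₂ p)) padded-type₂ (Allₚ.++⁺ lifted-type₁ raised-nonzero))
      where
      lifted-unique : Unique (when (a + b ≤? k) (map raise (E₁ f a b (k ∸ (a + b)))))
      lifted-unique = when-unique (a + b ≤? k) (Uniqueₚ.map⁺ raise-injective (E₁-unique f a b _))
      padded-type₂ : All (λ p → SecondEndsInZero p × ¬ Type₁ (unpad₂ p)) (map pad₂ (E₂ f a b k))
      padded-type₂ = Allₚ.map⁺ (All.map (λ {x} ¬t → pad₂-ends-in-zero x , subst (¬_ ∘ Type₁) (sym (unpad₂-pad₂ x)) ¬t)
                                        (E₂-¬type₁ f a b k))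
      lifted-type₁ : All (λ p → ¬ (SecondEndsInZero p × ¬ Type₁ (unpad₂ p)))
                         (map pad₂ (when (a + b ≤? k) (map raise (E₁ f a b (k ∸ (a + b))))))
      lifted-type₁ = Allₚ.map⁺ (All-when (a + b ≤? k) (λ _ → Allₚ.map⁺ (All.map
        (λ {y} t (_ , ¬t) → ¬t (subst Type₁ (sym (unpad₂-pad₂ (raise y))) (Type₁-raise y t))) (E₁-type₁ f a b _))))
      raised-nonzero : All (λ p → ¬ (SecondEndsInZero p × ¬ Type₁ (unpad₂ p)))
                           (when (a + suc b ≤? k) (map raise (E₂ f a (suc b) (k ∸ (a + suc b)))))
      raised-nonzero = All.map (λ ¬ends (ends , _) → ¬ends ends) (raised-ends-positive f a b k)
    E₂-step-unique f a b k (outer _ _) = []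

    raised-unique : ∀ f a b k → Unique (when (a + suc b ≤? k) (map raise (E₂ f a (suc b) (k ∸ (a + suc b)))))
    raised-unique f a b k = when-unique (a + suc b ≤? k) (Uniqueₚ.map⁺ raise-injective (E₂-unique f a (suc b) _))

  private
    raised-sound : ∀ {a b k} → b ≤ a → a ≤ b + 4 → {xs : List (Pair a b)} →
      All (IsCylindric a b (k ∸ (a + b))) xs → All (IsCylindric a b k) (when (a + b ≤? k) (map raise xs))
    raised-sound {a} {b} {k} b≤a a≤b+4 xs-sound = All-when (a + b ≤? k) (λ N≤k → Allₚ.map⁺ (All.map
      (λ {y} v → subst (λ m → IsCylindric a b m (raise y)) (ℕ.m∸n+n≡m N≤k) (IsCylindric-raise b≤a a≤b+4 y v)) xs-sound))

  mutual
    E-sound : ∀ f a b k → b ≤ a → a ≤ b + 4 → All (IsCylindric a b k) (E f a b k)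
    E-sound f a b k b≤a a≤b+4 = Allₚ.++⁺ (E₁-sound f a b k b≤a a≤b+4) (E₂-sound f a b k b≤a a≤b+4)

    E₁-sound : ∀ f a b k → b ≤ a → a ≤ b + 4 → All (IsCylindric a b k) (E₁ f a b k)
    E₁-sound zero    _       _ _ _ _ = []
    E₁-sound (suc f) zero    b k _ _ = []
    E₁-sound (suc f) (suc a) b k b≤a+1 a+1≤b+4 = All-when (b ≤? a) (λ b≤a →
      Allₚ.++⁺ (Allₚ.map⁺ (All.map (λ {x} → IsCylindric-pad₁ x) (E-sound f a b k b≤a (ℕ.<⇒≤ a+1≤b+4))))
               (raised-sound b≤a+1 a+1≤b+4 (E₁-sound f (suc a) b _ b≤a+1 a+1≤b+4)))

    E₂-sound : ∀ f a b k → b ≤ a → a ≤ b + 4 → All (IsCylindric a b k) (E₂ f a b k)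
    E₂-sound zero    _       _       _ _     _     = []
    E₂-sound (suc f) a       (suc b) k b+1≤a a≤b+5 = E₂-step-sound f a b k (shape₂ a b) b+1≤a a≤b+5
    E₂-sound (suc f) zero    zero    k _     _     = All-when (k ≟ 0) (λ { refl → empty-pair ∷ [] })
      where
      empty-pair : IsCylindric 0 0 0 ([] , [])
      empty-pair = (λ _ → z≤n) , (λ _ → z≤n) , (λ _ → z≤n) , (λ _ → z≤n) , refl
    E₂-sound (suc f) (suc a) zero    k _     _     = []

    E₂-step-sound : ∀ f a b k s → suc b ≤ a → a ≤ suc b + 4 → All (IsCylindric a (suc b) k) (E₂-step f a b k s)
    E₂-step-sound f a b k (square refl) b+1≤a a≤b+5 =
      Allₚ.++⁺ (Allₚ.map⁺ (All.map (λ {x} → IsCylindric-pad₂ x) (E-sound f a b k (ℕ.n≤1+n b) (b+1≤b+4 b))))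
               (raised-sound b+1≤a a≤b+5 (E₂-sound f a (suc b) _ b+1≤a a≤b+5))
    E₂-step-sound f a b k (inner b+2≤a a≤b+4) b+1≤a a≤b+5 =
      Allₚ.++⁺ (Allₚ.map⁺ (All.map (λ {x} → IsCylindric-pad₂ x) (E₂-sound f a b k b≤a a≤b+4)))
      (Allₚ.++⁺ (Allₚ.map⁺ (All.map (λ {x} → IsCylindric-pad₂ x)
                                     (raised-sound b≤a a≤b+4 (E₁-sound f a b _ b≤a a≤b+4))))
                (raised-sound b+1≤a a≤b+5 (E₂-sound f a (suc b) _ b+1≤a a≤b+5)))
      where
      b≤a = ℕ.<⇒≤ b+1≤a
    E₂-step-sound f a b k (outer _ _) _ _ = []

  private
    padded₁-complete : ∀ {a b k} {xs : List (Pair a b)} (p : Pair (suc a) b) → part (proj₁ p) a ≡ 0 →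
      IsCylindric (suc a) b k p → (IsCylindric a b k (unpad₁ p) → unpad₁ p ∈ xs) → p ∈ map pad₁ xs
    padded₁-complete p last≡0 v complete = subst (_∈ _) (pad₁-unpad₁ p last≡0) (∈-map⁺ pad₁ (complete
      (IsCylindric-pad₁⁻¹ (unpad₁ p) (subst (IsCylindric _ _ _) (sym (pad₁-unpad₁ p last≡0)) v))))

    padded₂-complete : ∀ {a b k} {xs : List (Pair a b)} (p : Pair a (suc b)) → part (proj₂ p) b ≡ 0 →
      IsCylindric a (suc b) k p → (IsCylindric a b k (unpad₂ p) → unpad₂ p ∈ xs) → p ∈ map pad₂ xs
    padded₂-complete p last≡0 v complete = subst (_∈ _) (pad₂-unpad₂ p last≡0) (∈-map⁺ pad₂ (complete
      (IsCylindric-pad₂⁻¹ (unpad₂ p) (subst (IsCylindric _ _ _) (sym (pad₂-unpad₂ p last≡0)) v))))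

    raised-complete : ∀ {a b k} → b ≤ a → a ≤ b + 4 → {xs : List (Pair a b)} (p : Pair a b) → AllPositive p →
      IsCylindric a b k p → (a + b ≤ k → IsCylindric a b (k ∸ (a + b)) (lower p) → lower p ∈ xs) →
      p ∈ when (a + b ≤? k) (map raise xs)
    raised-complete {a} {b} {k} b≤a a≤b+4 p pos v complete
      with IsCylindric-raise⁻¹ b≤a a≤b+4 (lower p) (subst (IsCylindric a b k) (sym (raise-lower p pos)) v)
    ... | N≤k , v′ = ∈-when⁺ (a + b ≤? k) N≤k (subst (_∈ _) (raise-lower p pos) (∈-map⁺ raise (complete N≤k v′)))

    lower-type₁ : ∀ {a b} (p : Pair a b) → AllPositive p → Type₁ p → Type₁ (lower p)
    lower-type₁ p pos t = Type₁-raise⁻¹ (lower p) (subst Type₁ (sym (raise-lower p pos)) t)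

    lower-¬type₁ : ∀ {a b} (p : Pair a b) → AllPositive p → ¬ Type₁ p → ¬ Type₁ (lower p)
    lower-¬type₁ p pos ¬t = ¬t ∘ subst Type₁ (raise-lower p pos) ∘ Type₁-raise (lower p)

    second-positive : ∀ {a b} (u : Vec ℕ a) (w : Vec ℕ b) → IsPartition w → 1 ≤ part u (ℕ.pred a) →
      b ≡ 0 ⊎ part u (ℕ.pred a) ≤ part w (ℕ.pred b) → ∀ j → j < b → 1 ≤ part w j
    second-positive {b = zero}  u w pw _       _                  j ()
    second-positive {b = suc b} u w pw last≥1 (inj₂ last≤last) = last-part-positive w pw (ℕ.≤-trans last≥1 last≤last)

    outer-type₁ : ∀ {a b k} (p : Pair a (suc b)) → suc b ≤ a → a ≤ suc b + 4 → a ≢ suc b →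
      ¬ (suc (suc b) ≤ a × a ≤ b + 4) → IsCylindric a (suc b) k p → Type₁ p
    outer-type₁ {a} {b} (u , w) b<a a≤b+5 a≢b+1 ¬inner (_ , _ , _ , u≤w , _) =
      b+1<a , inj₂ (subst (λ i → part u i ≤ part w b) (cong ℕ.pred (sym a≡b+5)) (u≤w b))
      where
      b+1<a : suc b < a
      b+1<a = ℕ.≤∧≢⇒< b<a (a≢b+1 ∘ sym)
      a≡b+5 : a ≡ suc (b + 4)
      a≡b+5 = ℕ.≤-antisym a≤b+5 (ℕ.≰⇒> (λ a≤b+4 → ¬inner (b+1<a , a≤b+4)))

  mutual
    E-complete : ∀ f a b k → a + b + k < f → b ≤ a → a ≤ b + 4 → ∀ p → IsCylindric a b k p → p ∈ E f a b k
    E-complete f a b k bound b≤a a≤b+4 p v with type₁? p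
    ... | yes t  = ∈-++⁺ˡ (E₁-complete f a b k bound a≤b+4 p v t)
    ... | no ¬t = ∈-++⁺ʳ (E₁ f a b k) (E₂-complete f a b k bound b≤a a≤b+4 p v ¬t)

    E₁-complete : ∀ f a b k → a + b + k < f → a ≤ b + 4 → ∀ p → IsCylindric a b k p → Type₁ p → p ∈ E₁ f a b k
    E₁-complete (suc f) (suc a) b k (s≤s bound) a<b+4 (u , w) v (s≤s b≤a , ends)
      rewrite E₁-unfold f a b k b≤a with part u a ≟ 0
    ... | yes last≡0 = ∈-++⁺ˡ (padded₁-complete (u , w) last≡0 v (E-complete f a b k bound b≤a (ℕ.<⇒≤ a<b+4) _))
    ... | no last≢0  = ∈-++⁺ʳ (map pad₁ (E f a b k)) (raised-complete (ℕ.m≤n⇒m≤1+n b≤a) a<b+4 (u , w) pos v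
        (λ N≤k v′ → E₁-complete f (suc a) b _ (fuel-raise N≤k (below-fuel (suc a + b) (s≤s z≤n) bound)) a<b+4
                      (lower (u , w)) v′ (lower-type₁ (u , w) pos (s≤s b≤a , ends))))
      where
      last≥1 : 1 ≤ part u a
      last≥1 = ℕ.n≢0⇒n>0 last≢0
      pos : AllPositive (u , w)
      pos = last-part-positive u (proj₁ v) last≥1 , second-positive u w (proj₁ (proj₂ v)) last≥1 ends

    E₂-complete : ∀ f a b k → a + b + k < f → b ≤ a → a ≤ b + 4 → ∀ p →
      IsCylindric a b k p → ¬ Type₁ p → p ∈ E₂ f a b k
    E₂-complete (suc f) a       (suc b) k (s≤s bound) b<a a≤b+5 p v ¬t =
      E₂-step-complete f a b k (shape₂ a b) bound b<a a≤b+5 p v ¬t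
    E₂-complete (suc f) zero    zero    k _ _ _ ([] , []) (_ , _ , _ , _ , refl) _ = here refl
    E₂-complete (suc f) (suc a) zero    k _ _ _ p _ ¬t = contradiction (s≤s z≤n , inj₁ refl) ¬t

    E₂-step-complete : ∀ f a b k s → a + suc b + k ≤ f → suc b ≤ a → a ≤ suc b + 4 → ∀ p →
      IsCylindric a (suc b) k p → ¬ Type₁ p → p ∈ E₂-step f a b k s
    E₂-step-complete f .(suc b) b k (square refl) bound _ _ (u , w) v _ with part w b ≟ 0
    ... | yes last≡0 = ∈-++⁺ˡ (padded₂-complete (u , w) last≡0 v
        (E-complete f (suc b) b k (fuel-pad₂ (suc b) b bound) (ℕ.n≤1+n b) (b+1≤b+4 b) _))
    ... | no last≢0  = ∈-++⁺ʳ (map pad₂ (E f (suc b) b k)) (raised-complete ℕ.≤-refl (ℕ.m≤m+n (suc b) 4) (u , w) pos v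
        (λ N≤k v′ → E₂-complete f (suc b) (suc b) _ (fuel-raise N≤k (below-fuel (suc b + suc b) (s≤s z≤n) bound))
                      ℕ.≤-refl (ℕ.m≤m+n (suc b) 4) (lower (u , w)) v′ (¬Type₁-square (lower (u , w)))))
      where
      w-last≥1 : 1 ≤ part w b
      w-last≥1 = ℕ.n≢0⇒n>0 last≢0
      pos : AllPositive (u , w)
      pos = last-part-positive u (proj₁ v) (ℕ.≤-trans w-last≥1 (proj₁ (proj₂ (proj₂ v)) b)) ,
            last-part-positive w (proj₁ (proj₂ v)) w-last≥1
    E₂-step-complete f a b k (inner b+2≤a a≤b+4) bound _ _ = E₂-inner-complete f a b k b+2≤a a≤b+4 bound
    E₂-step-complete f a b k (outer a≢b+1 ¬inner) bound b<a a≤b+5 p v ¬t =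
      contradiction (outer-type₁ p b<a a≤b+5 a≢b+1 ¬inner v) ¬t

    E₂-inner-complete : ∀ f a b k (b+2≤a : suc (suc b) ≤ a) (a≤b+4 : a ≤ b + 4) → a + suc b + k ≤ f → ∀ p →
      IsCylindric a (suc b) k p → ¬ Type₁ p → p ∈ E₂-step f a b k (inner b+2≤a a≤b+4)
    E₂-inner-complete f a b k b+2≤a a≤b+4 bound (u , w) v ¬t with part w b ≟ 0
    ... | no last≢0 = ∈-++⁺ʳ (map pad₂ (E₂ f a b k)) (∈-++⁺ʳ (map pad₂ (when (a + b ≤? k) _))
        (raised-complete b<a (ℕ.m≤n⇒m≤1+n a≤b+4) (u , w) pos v
          (λ N≤k v′ → E₂-complete f a (suc b) _ (fuel-raise N≤k k<f) b<a (ℕ.m≤n⇒m≤1+n a≤b+4)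
                        (lower (u , w)) v′ (lower-¬type₁ (u , w) pos ¬t))))
      where
      b<a = ℕ.<⇒≤ b+2≤a
      k<f = below-fuel (a + suc b) (ℕ.<-≤-trans (s≤s z≤n) (ℕ.m≤n+m (suc b) a)) bound
      w-last≥1 : 1 ≤ part w b
      w-last≥1 = ℕ.n≢0⇒n>0 last≢0
      pos : AllPositive (u , w)
      pos = last-part-positive u (proj₁ v) (ℕ.≤-trans w-last≥1 (ℕ.<⇒≤ (ℕ.≰⇒> (λ u≤w → ¬t (b+2≤a , inj₂ u≤w))))) ,
            last-part-positive w (proj₁ (proj₂ v)) w-last≥1
    ... | yes last≡0 with type₁? (unpad₂ (u , w))
    ...   | no ¬t′ = ∈-++⁺ˡ (padded₂-complete (u , w) last≡0 v
        (λ v′ → E₂-complete f a b k (fuel-pad₂ a b bound) (ℕ.<⇒≤ (ℕ.<⇒≤ b+2≤a)) a≤b+4 _ v′ ¬t′))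
    ...   | yes t′ = ∈-++⁺ʳ (map pad₂ (E₂ f a b k)) (∈-++⁺ˡ (padded₂-complete (u , w) last≡0 v
        (λ v′ → raised-complete b≤a a≤b+4 (unpad₂ (u , w)) (pos v′) v′
          (λ N≤k v″ → E₁-complete f a b _ (fuel-raise N≤k k<f) a≤b+4 (lower (unpad₂ (u , w))) v″
                        (lower-type₁ (unpad₂ (u , w)) (pos v′) t′)))))
      where
      b≤a = ℕ.<⇒≤ (ℕ.<⇒≤ b+2≤a)
      k<f = below-fuel (a + suc b) (ℕ.<-≤-trans (s≤s z≤n) (ℕ.m≤n+m (suc b) a)) bound
      u-last≥1 : 1 ≤ part u (ℕ.pred a)
      u-last≥1 = ℕ.≰⇒> (λ u≤0 → ¬t (b+2≤a , inj₂ (subst (part u (ℕ.pred a) ≤_) (sym last≡0) u≤0)))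
      pos : IsCylindric a b k (unpad₂ (u , w)) → AllPositive (unpad₂ (u , w))
      pos v′ = last-part-positive u (proj₁ v′) u-last≥1 ,
               second-positive u (Vec.init w) (proj₁ (proj₂ v′)) u-last≥1 (proj₂ t′)

  enumerate-unique : ∀ a b k → Unique (enumerate a b k)
  enumerate-unique a b k = E-unique (suc (a + b + k)) a b k

  ∈-enumerate⇔ : ∀ {a b k} → b ≤ a → a ≤ b + 4 → ∀ p → (p ∈ enumerate a b k) ⇔ IsCylindric a b k p
  ∈-enumerate⇔ {a} {b} {k} b≤a a≤b+4 p =
    mk⇔ (All.lookup (E-sound (suc (a + b + k)) a b k b≤a a≤b+4)) (E-complete (suc (a + b + k)) a b k ℕ.≤-refl b≤a a≤b+4 p)

module GeneralizedIdentity where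

  open import Defs
  open PowerSeries
  open GaussianBinomial using (qPoch-suc-⊛-fixpoint)
  open RightHandSide
  open CylindricPairs
  open Enumeration
  open EnumerationCorrect
  open import Data.Nat as ℕ using (ℕ; zero; suc; z≤n; s≤s; _≤_; _+_)
  import Data.Nat.Properties as ℕ
  open import Data.Integer as ℤ using (ℤ)
  import Data.Integer.Properties as ℤ
  open import Data.Sum using (inj₁; inj₂)
  open import Relation.Binary.PropositionalEquality hiding (setoid)
  open import Relation.Binary.Reasoning.Setoid (ℕ →-setoid ℤ)
  open import Data.Integer.Solver using (module +-*-Solver)
  open +-*-Solver using (solve; _:+_; _:-_; _:=_)

  Identity : ℕ → ℕ → Set
  Identity a b = qPoch (a + b) ⊛ count a b ≗ rhs a b

  identity₁ : ∀ {a b} → b ≤ a → Identity a b → qPoch (suc a + b) ⊛ count₁ (suc a) b ≗ rhs a b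
  identity₁ {a} {b} b≤a ih = begin
    qPoch (suc a + b) ⊛ count₁ (suc a) b
      ≈⟨ qPoch-suc-⊛-fixpoint (a + b) (count₁ (suc a) b) (count a b) (count₁-rec b≤a) ⟩
    qPoch (a + b) ⊛ count a b
      ≈⟨ ih ⟩
    rhs a b ∎

  identity₂ : ∀ {a b} → b ≤ a → Identity (suc a) b → Identity a b →
    qPoch (suc a + b) ⊛ count₂ (suc a) b ≗ rhs (suc a) b ⊖ rhs a b
  identity₂ {a} {b} b≤a ih₊ ih = begin
    qPoch (suc a + b) ⊛ count₂ (suc a) b
      ≈⟨ ⊛-congʳ (qPoch (suc a + b)) count₂≗count⊖count₁ ⟩
    qPoch (suc a + b) ⊛ (count (suc a) b ⊖ count₁ (suc a) b)
      ≈⟨ ⊛-distribˡ-⊖ (qPoch (suc a + b)) (count (suc a) b) (count₁ (suc a) b) ⟩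
    qPoch (suc a + b) ⊛ count (suc a) b ⊖ qPoch (suc a + b) ⊛ count₁ (suc a) b
      ≈⟨ (λ k → cong₂ ℤ._-_ (ih₊ k) (identity₁ b≤a ih k)) ⟩
    rhs (suc a) b ⊖ rhs a b ∎
    where
    count₂≗count⊖count₁ : count₂ (suc a) b ≗ count (suc a) b ⊖ count₁ (suc a) b
    count₂≗count⊖count₁ k rewrite count-split (suc a) b k =
      solve 2 (λ x y → y := x :+ y :- x) refl (count₁ (suc a) b k) (count₂ (suc a) b k)

  identity-origin : Identity 0 0
  identity-origin = begin
    oneS ⊛ count 0 0            ≈⟨ ⊛-identityˡ (count 0 0) ⟩
    count 0 0                   ≈⟨ count≗count₂ 0 0 count₁-origin ⟩
    count₂ 0 0                  ≈⟨ count₂-origin ⟩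
    oneS                        ≈⟨ rhs-zero 0 z≤n ⟨
    rhs 0 0                     ∎

  identity-axis : ∀ {a} → a ≤ 3 → Identity a 0 → Identity (suc a) 0
  identity-axis {a} a≤3 ih = begin
    qPoch (suc a + 0) ⊛ count (suc a) 0   ≈⟨ ⊛-congʳ (qPoch (suc a + 0)) (count≗count₁ (suc a) 0 (count₂-axis a)) ⟩
    qPoch (suc a + 0) ⊛ count₁ (suc a) 0  ≈⟨ identity₁ z≤n ih ⟩
    rhs a 0                               ≈⟨ rhs-zero a (ℕ.m≤n⇒m≤1+n a≤3) ⟩
    oneS                                  ≈⟨ rhs-zero (suc a) (s≤s a≤3) ⟨
    rhs (suc a) 0                         ∎

  identity-square : ∀ {b} → Identity (suc b) b → Identity (suc b) (suc b)
  identity-square {b} ih = begin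
    qPoch (suc b + suc b) ⊛ count (suc b) (suc b)
      ≈⟨ ⊛-congʳ (qPoch (suc b + suc b)) (count≗count₂ (suc b) (suc b) (count₁-square b)) ⟩
    qPoch (suc b + suc b) ⊛ count₂ (suc b) (suc b)
      ≈⟨ qPoch-suc-⊛-fixpoint (b + suc b) (count₂ (suc b) (suc b)) (count (suc b) b) (count₂-square-rec b) ⟩
    qPoch (b + suc b) ⊛ count (suc b) b
      ≡⟨ cong (λ m → qPoch m ⊛ count (suc b) b) (ℕ.+-suc b b) ⟩
    qPoch (suc b + b) ⊛ count (suc b) b
      ≈⟨ ih ⟩
    rhs (suc b) b
      ≈⟨ rhs-diagonal-step b ⟨
    rhs (suc b) (suc b) ∎

  identity-top : ∀ {b} → Identity (3 + suc b) (suc b) → Identity (4 + suc b) (suc b)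
  identity-top {b} ih = begin
    qPoch (4 + suc b + suc b) ⊛ count (4 + suc b) (suc b)
      ≈⟨ ⊛-congʳ (qPoch (4 + suc b + suc b)) (count≗count₁ (4 + suc b) (suc b) (count₂-top b)) ⟩
    qPoch (4 + suc b + suc b) ⊛ count₁ (4 + suc b) (suc b)
      ≈⟨ identity₁ (ℕ.m≤n+m (suc b) 3) ih ⟩
    rhs (3 + suc b) (suc b)
      ≈⟨ rhs-offset-step (suc b) ⟨
    rhs (4 + suc b) (suc b) ∎

  identity₂-inner : ∀ {a b} → suc b ≤ a → suc a ≤ b + 4 → Identity (suc a) b → Identity a b →
    qPoch (suc a + suc b) ⊛ count₂ (suc a) (suc b) ≗ rhs (suc a) (suc b) ⊖ rhs a (suc b)
  identity₂-inner {a} {b} b<a a<b+4 ih₊ ih = begin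
    qPoch (suc a + suc b) ⊛ count₂ (suc a) (suc b)
      ≈⟨ qPoch-suc-⊛-fixpoint (a + suc b) (count₂ (suc a) (suc b)) (count₂ (suc a) b ⊕ shift (suc a + b) (count₁ (suc a) b))
           (count₂-inner-rec (s≤s b<a) a<b+4) ⟩
    qPoch (a + suc b) ⊛ (count₂ (suc a) b ⊕ shift (suc a + b) (count₁ (suc a) b))
      ≡⟨ cong (λ m → qPoch m ⊛ (count₂ (suc a) b ⊕ shift (suc a + b) (count₁ (suc a) b))) (ℕ.+-suc a b) ⟩
    qPoch (suc a + b) ⊛ (count₂ (suc a) b ⊕ shift (suc a + b) (count₁ (suc a) b))
      ≈⟨ ⊛-distribˡ-⊕ (qPoch (suc a + b)) (count₂ (suc a) b) (shift (suc a + b) (count₁ (suc a) b)) ⟩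
    qPoch (suc a + b) ⊛ count₂ (suc a) b ⊕ qPoch (suc a + b) ⊛ shift (suc a + b) (count₁ (suc a) b)
      ≈⟨ ⊕-cong (identity₂ b≤a ih₊ ih)
                (λ k → trans (⊛-shift (qPoch (suc a + b)) (suc a + b) (count₁ (suc a) b) k)
                             (shift-cong (suc a + b) (identity₁ b≤a ih) k)) ⟩
    rhs (suc a) b ⊖ rhs a b ⊕ shift (suc a + b) (rhs a b)
      ≈⟨ (λ k → sym (rearrange k)) ⟩
    rhs (suc a) (suc b) ⊖ rhs a (suc b) ∎
    where
    b≤a = ℕ.<⇒≤ b<a
    rearrange : ∀ k → rhs (suc a) (suc b) k ℤ.- rhs a (suc b) k
                    ≡ rhs (suc a) b k ℤ.- rhs a b k ℤ.+ shift (suc a + b) (rhs a b) k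
    rearrange k rewrite rhs-recurrence a b k =
      solve 4 (λ x y u w → x :+ y :- u :+ w :- x := y :- u :+ w) refl
        (rhs a (suc b) k) (rhs (suc a) b k) (rhs a b k) (shift (suc (a + b)) (rhs a b) k)

  identity-inner : ∀ {a b} → suc b ≤ a → suc a ≤ b + 4 →
    Identity a (suc b) → Identity (suc a) b → Identity a b → Identity (suc a) (suc b)
  identity-inner {a} {b} b<a a<b+4 ih₋ ih₊ ih = begin
    qPoch (suc a + suc b) ⊛ count (suc a) (suc b)
      ≈⟨ ⊛-congʳ (qPoch (suc a + suc b)) (count-split (suc a) (suc b)) ⟩
    qPoch (suc a + suc b) ⊛ (count₁ (suc a) (suc b) ⊕ count₂ (suc a) (suc b))
      ≈⟨ ⊛-distribˡ-⊕ (qPoch (suc a + suc b)) (count₁ (suc a) (suc b)) (count₂ (suc a) (suc b)) ⟩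
    qPoch (suc a + suc b) ⊛ count₁ (suc a) (suc b) ⊕ qPoch (suc a + suc b) ⊛ count₂ (suc a) (suc b)
      ≈⟨ ⊕-cong (identity₁ b<a ih₋) (identity₂-inner b<a a<b+4 ih₊ ih) ⟩
    rhs a (suc b) ⊕ (rhs (suc a) (suc b) ⊖ rhs a (suc b))
      ≈⟨ (λ k → solve 2 (λ x y → x :+ (y :- x) := y) refl (rhs a (suc b) k) (rhs (suc a) (suc b) k)) ⟩
    rhs (suc a) (suc b) ∎

  identity : ∀ a b → b ≤ a → a ≤ b + 4 → Identity a b
  identity zero    zero    _         _         = identity-origin
  identity (suc a) zero    _         (s≤s a≤3) = identity-axis a≤3 (identity a zero z≤n (ℕ.m≤n⇒m≤1+n a≤3))
  identity (suc a) (suc b) (s≤s b≤a) (s≤s a≤b+4) with ℕ.m≤n⇒m<n∨m≡n b≤a | ℕ.m≤n⇒m<n∨m≡n a≤b+4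
  ... | inj₂ refl | _         = identity-square (identity (suc b) b (ℕ.n≤1+n b) (b+1≤b+4 b))
  ... | inj₁ b<a  | inj₁ a<b+4 = identity-inner b<a a<b+4
    (identity a (suc b) b<a (ℕ.m≤n⇒m≤1+n a≤b+4)) (identity (suc a) b (ℕ.m≤n⇒m≤1+n b≤a) a<b+4) (identity a b b≤a a≤b+4)
  -- The top case recurses on a itself and transports along a ≡ 3 + suc b, keeping the call structural.
  ... | inj₁ b<a  | inj₂ a≡b+4 = subst (λ x → Identity (suc x) (suc b)) (sym a≡3+[1+b])
    (identity-top (subst (λ x → Identity x (suc b)) a≡3+[1+b] (identity a (suc b) b<a (ℕ.m≤n⇒m≤1+n a≤b+4))))
    where
    a≡3+[1+b] : a ≡ 3 + suc b
    a≡3+[1+b] = trans a≡b+4 (ℕ.+-comm b 4)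

open import Defs
open import Data.Nat using (ℕ; _*_)
open import Data.Integer using (ℤ; +_)
open import Data.Vec using (Vec)
open import Data.Product using (_×_)
open import Data.List using (List; length)
open import Data.List.Relation.Unary.Unique.Propositional using (Unique)
open import Data.List.Membership.Propositional using (_∈_)
open import Function.Bundles using (_⇔_)
open import Relation.Binary.PropositionalEquality using (_≡_)

open import Data.Nat using (_+_)
open import Data.Nat.Properties using (≤-refl; m≤m+n; +-identityʳ)
open import Data.List.Membership.Propositional.Properties.WithK using (unique∧set⇒bag)
open import Data.List.Relation.Binary.BagAndSetEquality using (∼bag⇒↭)
open import Data.List.Relation.Binary.Permutation.Propositional.Properties using (↭-length)
open import Function.Properties.Equivalence using () renaming (trans to ⇔-trans; sym to ⇔-sym)
open import Relation.Binary.PropositionalEquality using (_≗_; cong; module ≡-Reasoning)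
open PowerSeries using (⊛-cong)
open RightHandSide using (rhs; rhs-diagonal)
open CylindricPairs using (IsCP40⇔IsCylindric)
open Enumeration using (count)
open EnumerationCorrect using (enumerate-unique; ∈-enumerate⇔)
open GeneralizedIdentity using (identity)

unique∧set⇒length≡ : ∀ {A : Set} {xs ys : List A} → Unique xs → Unique ys →
  (∀ {x} → (x ∈ xs) ⇔ (x ∈ ys)) → length xs ≡ length ys
unique∧set⇒length≡ xs! ys! xs⇔ys = ↭-length (∼bag⇒↭ (unique∧set⇒bag xs! ys! xs⇔ys))

theorem5p2 : (n : ℕ) (L : ℕ → List (Vec ℕ n × Vec ℕ n)) →
    (∀ k → Unique (L k)) →
    (∀ k p → (p ∈ L k) ⇔ IsCP40 n k p) →
    ∀ N → (qPoch (2 * n) ⊛ (λ k → + length (L k))) N ≡ rhsCoeff n N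
theorem5p2 n L L-unique L-complete N = begin
  (qPoch (2 * n) ⊛ (λ k → + length (L k))) N  ≡⟨ ⊛-cong (λ M → cong (λ m → qPoch m M) 2n≡n+n) L≗count N ⟩
  (qPoch (n + n) ⊛ count n n) N              ≡⟨ identity n n ≤-refl (m≤m+n n 4) N ⟩
  rhs n n N                                  ≡⟨ rhs-diagonal n N ⟩
  rhsCoeff n N                               ∎
  where
  open ≡-Reasoning
  2n≡n+n : 2 * n ≡ n + n
  2n≡n+n = cong (_+_ n) (+-identityʳ n)
  L≗count : (λ k → + length (L k)) ≗ count n n
  L≗count k = cong +_ (unique∧set⇒length≡ (L-unique k) (enumerate-unique n n k) (λ {p} →
    ⇔-trans (L-complete k p) (⇔-trans (IsCP40⇔IsCylindric n k p) (⇔-sym (∈-enumerate⇔ ≤-refl (m≤m+n n 4) p)))))
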